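{- Let $q$ be a prime power, $n\ge 2$ and $0<k<n$. Then the uniform $q$-matroid $\mathcal U_{k,n}(q)$ on $\mathbb F_q^n$ is not purely $m$-multilinear for any integer $m>1$.
   Context: Let $E=\mathbb F_q^n$, $\mathcal L(E)$ the set of its subspaces, $U^\perp$ the orthogonal complement under the standard dot product. $\mathcal U_{k,n}(q)=(\mathcal L(E),\rho)$ with $\rho(V)=\min\{k,\dim V\}$. For an $\mathbb F_q$-linear $\mathcal C\subseteq\mathbb F_q^{n\times m}$ of dimension $k'$, $\mathcal C(W)=\{M\in\mathcal C:\operatorname{colsp}(M)\subseteq W\}$ and $\rho_{\mathcal C}(U)=(k'-\dim\mathcal C(U^\perp))/m$; a $q$-matroid is $\mathbb F_q^{n\times m}$-representable if its rank function equals $\rho_{\mathcal C}$ for some such $\mathcal C$. For $x\in\mathbb F_{q^m}^n$, $\operatorname{supp}(x)\subseteq\mathbb F_q^n$ is the column space of the $n\times m$ matrix over $\mathbb F_q$ obtained by expanding each coordinate of $x$ in a fixed $\mathbb F_q$-basis of $\mathbb F_{q^m}$. A $q$-matroid is $\mathbb F_{q^m}$-representable if its rank function is $W\mapsto K-\dim_{\mathbb F_{q^m}}\{x\in\mathcal C:\operatorname{supp}(x)\subseteq W^\perp\}$ for some $\mathbb F_{q^m}$-linear subspace $\mathcal C\subseteq\mathbb F_{q^m}^n$ of $\mathbb F_{q^m}$-dimension $K$. For $m>1$, a $q$-matroid is purely $m$-multilinear if it is $\mathbb F_q^{n\times m}$-representable but not $\mathbb F_{q^m}$-representable. -}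

module Defs where

open import Level using (0ℓ) renaming (suc to lsuc)
open import Data.Nat using (ℕ; zero; suc; _⊓_; _<_; _≤_) renaming (_+_ to _+ℕ_; _*_ to _*ℕ_; _^_ to _^ℕ_)
open import Data.Nat.Primality using (Prime)
open import Data.Fin using (Fin)
import Data.Fin as Fin
open import Data.Product using (Σ; ∃; ∃-syntax; _×_; _,_)
open import Relation.Nullary using (¬_)
open import Relation.Binary.PropositionalEquality using (_≡_)
import Relation.Binary.PropositionalEquality as ≡
open import Algebra.Bundles using (CommutativeRing)
open import Algebra.Morphism.Structures using (IsRingHomomorphism)
open import Function.Bundles using (Bijection)

record Field : Set₁ where
  field
    commutativeRing : CommutativeRing 0ℓ 0ℓ
  open CommutativeRing commutativeRing public
  field
    0≉1     : ¬ (0# ≈ 1#)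
    inverse : ∀ x → ¬ (x ≈ 0#) → ∃[ y ] (x * y ≈ 1#)

HasCard : Field → ℕ → Set
HasCard F q = Bijection (Field.setoid F) (≡.setoid (Fin q))

IsPrimePower : ℕ → Set
IsPrimePower q = ∃[ p ] ∃[ e ] (Prime p × 0 < e × q ≡ p ^ℕ e)

IsFieldHom : (F L : Field) → (Field.Carrier F → Field.Carrier L) → Set
IsFieldHom F L ι = IsRingHomomorphism (Field.rawRing F) (Field.rawRing L) ι

module LinAlg (K : Field) where
  open Field K

  Vect : Set → Set
  Vect I = I → Carrier

  _≈v_ : {I : Set} → Vect I → Vect I → Set
  u ≈v v = ∀ i → u i ≈ v i

  0v : {I : Set} → Vect I
  0v i = 0#

  _+v_ : {I : Set} → Vect I → Vect I → Vect I
  (u +v v) i = u i + v i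

  _·v_ : {I : Set} → Carrier → Vect I → Vect I
  (a ·v v) i = a * v i

  sumFin : ∀ {d} → (Fin d → Carrier) → Carrier
  sumFin {zero}  f = 0#
  sumFin {suc d} f = f Fin.zero + sumFin (λ j → f (Fin.suc j))

  lincomb : ∀ {I d} → (Fin d → Carrier) → (Fin d → Vect I) → Vect I
  lincomb c v i = sumFin (λ j → c j * v j i)

  Pred : Set → Set₁
  Pred I = Vect I → Set

  _⊆_ : {I : Set} → Pred I → Pred I → Set
  S ⊆ T = ∀ x → S x → T x

  Span : ∀ {I d} → (Fin d → Vect I) → Pred I
  Span v x = ∃[ c ] (x ≈v lincomb c v)

  LinIndep : ∀ {I d} → (Fin d → Vect I) → Set
  LinIndep v = ∀ c → lincomb c v ≈v 0v → ∀ j → c j ≈ 0#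

  HasDim : {I : Set} → Pred I → ℕ → Set
  HasDim S d = Σ (Fin d → Vect _) λ b →
                 (∀ j → S (b j)) × LinIndep b × (S ⊆ Span b)

  record Subspace (I : Set) : Set₁ where
    field
      mem     : Pred I
      resp    : ∀ {x y} → x ≈v y → mem x → mem y
      has0    : mem 0v
      closed+ : ∀ {x y} → mem x → mem y → mem (x +v y)
      closed· : ∀ a {x} → mem x → mem (a ·v x)

  open Subspace public

  dot : ∀ {n} → Vect (Fin n) → Vect (Fin n) → Carrier
  dot x y = sumFin (λ i → x i * y i)

  perp : ∀ {n} → Pred (Fin n) → Pred (Fin n)
  perp U x = ∀ u → U u → dot x u ≈ 0#

  Mat : ℕ → ℕ → Set
  Mat n m = Vect (Fin n × Fin m)

  col : ∀ {n m} → Mat n m → Fin m → Vect (Fin n)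
  col M j i = M (i , j)

  colsp : ∀ {n m} → Mat n m → Pred (Fin n)
  colsp M = Span (col M)

-- q-matroids on F^n given by their rank function, presented as a
-- relation  R U r  meaning  ρ(U) = r.

module QMatroid (F : Field) (n : ℕ) where
  open LinAlg F

  RankRel : Set₁
  RankRel = Subspace (Fin n) → ℕ → Set

  uniformRank : ℕ → RankRel
  uniformRank k V r = ∃[ d ] (HasDim (mem V) d × r ≡ k ⊓ d)

  restrict : ∀ {m} → Pred (Fin n × Fin m) → Pred (Fin n) → Pred (Fin n × Fin m)
  restrict C W M = C M × (colsp M ⊆ W)

  -- F^{n×m}-representable:  ρ(U) = (k' − dim C(U^⊥)) / m  for all U,
  -- written in ℕ as  m·ρ(U) + dim C(U^⊥) = k'.
  MatRepresentable : ℕ → RankRel → Set₁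
  MatRepresentable m ρ =
    Σ (Subspace (Fin n × Fin m)) λ C → Σ ℕ λ k' →
      HasDim (mem C) k' ×
      (∀ (U : Subspace (Fin n)) r e → ρ U r →
         HasDim (restrict (mem C) (perp (mem U))) e → m *ℕ r +ℕ e ≡ k')

  -- F_{q^m}-representability, relative to an extension field L of F
  -- given by an embedding ι : F → L and an F-basis γ of L.
  module Ext (L : Field) (ι : Field.Carrier F → Field.Carrier L)
             {m : ℕ} (γ : Fin m → Field.Carrier L) where
    module LL = LinAlg L
    open Field L using () renaming (_≈_ to _≈L_; _*_ to _*L_)

    IsExpansion : LL.Vect (Fin n) → Mat n m → Set
    IsExpansion x A = ∀ i → x i ≈L LL.sumFin (λ j → ι (A (i , j)) *L γ j)

    -- supp(x) ⊆ W  (supp(x) = column space of the expansion matrix)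
    SuppIn : LL.Vect (Fin n) → Pred (Fin n) → Set
    SuppIn x W = ∃[ A ] (IsExpansion x A × (colsp A ⊆ W))

    ExtRepresentable : RankRel → Set₁
    ExtRepresentable ρ =
      Σ (LL.Subspace (Fin n)) λ C → Σ ℕ λ K →
        LL.HasDim (LL.mem C) K ×
        (∀ (W : Subspace (Fin n)) r e → ρ W r →
           LL.HasDim (λ x → LL.mem C x × SuppIn x (perp (mem W))) e →
           r +ℕ e ≡ K)

    PurelyMultilinear : RankRel → Set₁
    PurelyMultilinear ρ = 1 < m × MatRepresentable m ρ × ¬ ExtRepresentable ρ

module _ (F L : Field) (ι : Field.Carrier F → Field.Carrier L) where
  open Field L using () renaming (_≈_ to _≈L_; _*_ to _*L_)
  private module LL = LinAlg L
  private module FF = LinAlg F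

  IsBasisOver : ∀ {m} → (Fin m → Field.Carrier L) → Set
  IsBasisOver {m} γ =
    (∀ (c : Fin m → Field.Carrier F) →
       LL.sumFin (λ j → ι (c j) *L γ j) ≈L Field.0# L →
       ∀ j → Field._≈_ F (c j) (Field.0# F)) ×
    (∀ (x : Field.Carrier L) → Σ (Fin m → Field.Carrier F) λ c → (x ≈L LL.sumFin (λ j → ι (c j) *L γ j)))

module Submission where

-- If n ≤ m, U_{k,n} is F_{q^m}-representable by a Gabidulin code: for n F_q-independent elements
-- g_j of F_{q^m}, let C be spanned by the k rows (g_j^{q^i})_j, i < k. For W ⊆ F_q^n with basis
-- w_1 … w_d, the codeword Σ_i y_i (g_j^{q^i})_j has support in W^⊥ exactly when the q-polynomial
-- Σ_i y_i z^{q^i} vanishes at the F_q-independent elements Σ_j w_{l,j} g_j; since a q-polynomial of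
-- q-degree < s vanishing on s independent elements vanishes on their q^s F_q-combinations, it is
-- zero, so these Moore systems have full rank and dim C(W^⊥) = k - min(k, d).
-- If n > m, U_{k,n} is not even F_q^{n×m}-representable: a representing code C has dimension m k;
-- writing m = t + r with r + k ≤ n and n t < m k, some nonzero M ∈ C has its first t columns zero,
-- and the annihilator U of its last r columns has dimension ≥ n - r ≥ k, so C(U^⊥) = 0 although
-- M ∈ C(U^⊥).

open import Defs
open import Level using (0ℓ)
open import Algebra.Bundles using (CommutativeRing)
open import Data.Nat as ℕ using (ℕ; zero; suc; _<_; _≤_; _⊓_) renaming (_+_ to _+ℕ_; _*_ to _*ℕ_; _^_ to _^ℕ_)
import Data.Nat.Properties as ℕ
open import Data.Fin as Fin using (Fin; zero; suc; _↑ˡ_; _↑ʳ_)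
import Data.Fin.Properties as Finₚ
open import Data.Product using (Σ; ∃-syntax; _×_; _,_; proj₁; proj₂)
open import Data.Sum using (_⊎_; inj₁; inj₂)
open import Data.Empty using (⊥; ⊥-elim)
open import Data.Nat.Primality using (Prime)
open import Algebra.Morphism.Structures using (IsRingHomomorphism)
import Algebra.Definitions.RawMonoid
import Algebra.Properties.Semiring.Exp
open import Relation.Nullary using (¬_; Dec; yes; no; ¬?; contradiction)
open import Relation.Nullary.Decidable using (decidable-stable)
open import Relation.Binary.PropositionalEquality as ≡ using (_≡_; _≢_)
import Data.Vec.Functional as Vec
import Data.Vec.Functional.Properties as VecF

↑ˡ-or-↑ʳ : ∀ {a b} (j : Fin (a +ℕ b)) → (∃[ i ] i ↑ˡ b ≡ j) ⊎ (∃[ i ] a ↑ʳ i ≡ j)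
↑ˡ-or-↑ʳ {a} j with Fin.splitAt a j in eq
... | inj₁ i = inj₁ (i , Finₚ.splitAt⁻¹-↑ˡ eq)
... | inj₂ i = inj₂ (i , Finₚ.splitAt⁻¹-↑ʳ eq)

^-injectiveʳ : ∀ {m a b} → 1 < m → m ^ℕ a ≡ m ^ℕ b → a ≡ b
^-injectiveʳ {m} 1<m eq = ℕ.≤-antisym
  (ℕ.≮⇒≥ (λ b<a → ℕ.<-irrefl (≡.sym eq) (ℕ.^-monoʳ-< m 1<m b<a)))
  (ℕ.≮⇒≥ (λ a<b → ℕ.<-irrefl eq (ℕ.^-monoʳ-< m 1<m a<b)))

funToFin-cong : ∀ {m n} {f g : Fin m → Fin n} → (∀ i → f i ≡ g i) → Fin.funToFin f ≡ Fin.funToFin g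
funToFin-cong {zero}  f≗g = ≡.refl
funToFin-cong {suc m} f≗g = ≡.cong₂ Fin.combine (f≗g zero) (funToFin-cong (λ i → f≗g (suc i)))

-- The standard ring solver needs coefficients with decidable equality; ℤ maps into every
-- commutative ring.
module IntegerRingSolver (R : CommutativeRing 0ℓ 0ℓ) where

  open import Data.Integer as ℤ using (ℤ; +_; -[1+_]; _⊖_)
  import Data.Integer.Properties as ℤ
  open import Data.Sign as Sign using ()
  open import Data.Maybe using (Maybe; just; nothing)
  import Algebra.Solver.Ring.AlmostCommutativeRing as ACR

  open CommutativeRing R
  open import Relation.Binary.Reasoning.Setoid setoid
  open import Algebra.Properties.Ring ring using (-‿distribˡ-*; -‿distribʳ-*)
  open import Algebra.Properties.AbelianGroup +-abelianGroup using (⁻¹-∙-comm; ⁻¹-involutive; ε⁻¹≈ε)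
  open import Algebra.Properties.Semiring.Mult.TCOptimised semiring
    using () renaming (_×_ to _×′_; 1+× to 1+×′; ×-homo-+ to ×′-homo-+; ×1-homo-* to ×′1-homo-*)

  ⟦_⟧ : ℤ → Carrier
  ⟦ + n ⟧      = n ×′ 1#
  ⟦ -[1+ n ] ⟧ = - (suc n ×′ 1#)

  private
    -‿+-distrib : ∀ a b → - (a + b) ≈ - a + - b
    -‿+-distrib a b = sym (⁻¹-∙-comm a b)

    1+-cancel : ∀ a b → (1# + a) - (1# + b) ≈ a - b
    1+-cancel a b = begin
      (1# + a) + - (1# + b)    ≈⟨ +-congˡ (-‿+-distrib 1# b) ⟩
      (1# + a) + (- 1# + - b)  ≈⟨ +-congʳ (+-comm 1# a) ⟩
      (a + 1#) + (- 1# + - b)  ≈⟨ +-assoc a 1# _ ⟩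
      a + (1# + (- 1# + - b))  ≈⟨ +-congˡ (sym (+-assoc 1# (- 1#) (- b))) ⟩
      a + ((1# - 1#) + - b)    ≈⟨ +-congˡ (+-congʳ (-‿inverseʳ 1#)) ⟩
      a + (0# + - b)           ≈⟨ +-congˡ (+-identityˡ (- b)) ⟩
      a - b                    ∎

  ⊖-homo : ∀ m n → ⟦ m ⊖ n ⟧ ≈ m ×′ 1# - n ×′ 1#
  ⊖-homo m zero rewrite ℤ.⊖-≥ (ℕ.z≤n {m}) = sym (trans (+-congˡ ε⁻¹≈ε) (+-identityʳ _))
  ⊖-homo zero (suc n) rewrite ℤ.⊖-< (ℕ.z<s {n}) = sym (+-identityˡ _)
  ⊖-homo (suc m) (suc n) rewrite ℤ.[1+m]⊖[1+n]≡m⊖n m n = begin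
    ⟦ m ⊖ n ⟧                             ≈⟨ ⊖-homo m n ⟩
    m ×′ 1# - n ×′ 1#                     ≈⟨ 1+-cancel _ _ ⟨
    (1# + m ×′ 1#) - (1# + n ×′ 1#)       ≈⟨ +-cong (1+×′ m 1#) (-‿cong (1+×′ n 1#)) ⟨
    suc m ×′ 1# - suc n ×′ 1#             ∎

  -‿homo : ∀ i → ⟦ ℤ.- i ⟧ ≈ - ⟦ i ⟧
  -‿homo -[1+ n ]    = sym (⁻¹-involutive _)
  -‿homo (+ zero)    = sym ε⁻¹≈ε
  -‿homo (+ suc n)   = refl

  +-homo : ∀ i j → ⟦ i ℤ.+ j ⟧ ≈ ⟦ i ⟧ + ⟦ j ⟧
  +-homo -[1+ m ] -[1+ n ] = begin
    - (suc (suc (m +ℕ n)) ×′ 1#)          ≡⟨ ≡.cong (λ k → - (suc k ×′ 1#)) (ℕ.+-suc m n) ⟨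
    - ((suc m +ℕ suc n) ×′ 1#)            ≈⟨ -‿cong (×′-homo-+ 1# (suc m) (suc n)) ⟩
    - (suc m ×′ 1# + suc n ×′ 1#)         ≈⟨ -‿+-distrib _ _ ⟩
    - (suc m ×′ 1#) + - (suc n ×′ 1#)     ∎
  +-homo -[1+ m ] (+ n)    = trans (⊖-homo n (suc m)) (+-comm _ _)
  +-homo (+ m)    -[1+ n ] = ⊖-homo m (suc n)
  +-homo (+ m)    (+ n)    = ×′-homo-+ 1# m n

  private
    -◃-homo : ∀ k → ⟦ Sign.- ℤ.◃ k ⟧ ≈ - (k ×′ 1#)
    -◃-homo k rewrite ℤ.-◃n≡-n k = -‿homo (+ k)

    +◃-homo : ∀ k → ⟦ Sign.+ ℤ.◃ k ⟧ ≈ k ×′ 1#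
    +◃-homo k rewrite ℤ.+◃n≡+n k = refl

  *-homo : ∀ i j → ⟦ i ℤ.* j ⟧ ≈ ⟦ i ⟧ * ⟦ j ⟧
  *-homo -[1+ m ] -[1+ n ] = begin
    ⟦ Sign.+ ℤ.◃ (suc m *ℕ suc n) ⟧       ≈⟨ +◃-homo (suc m *ℕ suc n) ⟩
    (suc m *ℕ suc n) ×′ 1#                ≈⟨ ×′1-homo-* (suc m) (suc n) ⟩
    a * b                                 ≈⟨ ⁻¹-involutive _ ⟨
    - - (a * b)                           ≈⟨ -‿cong (-‿distribˡ-* a b) ⟩
    - (- a * b)                           ≈⟨ -‿distribʳ-* (- a) b ⟩
    - a * - b                             ∎
    where
    a b : Carrier
    a = suc m ×′ 1#
    b = suc n ×′ 1#
  *-homo -[1+ m ] (+ n) = begin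
    ⟦ Sign.- ℤ.◃ (suc m *ℕ n) ⟧           ≈⟨ -◃-homo (suc m *ℕ n) ⟩
    - ((suc m *ℕ n) ×′ 1#)                ≈⟨ -‿cong (×′1-homo-* (suc m) n) ⟩
    - (suc m ×′ 1# * n ×′ 1#)             ≈⟨ -‿distribˡ-* _ _ ⟩
    - (suc m ×′ 1#) * n ×′ 1#             ∎
  *-homo (+ m) -[1+ n ] = begin
    ⟦ Sign.- ℤ.◃ (m *ℕ suc n) ⟧           ≈⟨ -◃-homo (m *ℕ suc n) ⟩
    - ((m *ℕ suc n) ×′ 1#)                ≈⟨ -‿cong (×′1-homo-* m (suc n)) ⟩
    - (m ×′ 1# * suc n ×′ 1#)             ≈⟨ -‿distribʳ-* _ _ ⟩
    m ×′ 1# * - (suc n ×′ 1#)             ∎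
  *-homo (+ m) (+ n) = trans (+◃-homo (m *ℕ n)) (×′1-homo-* m n)

  private
    almostRing : ACR.AlmostCommutativeRing 0ℓ 0ℓ
    almostRing = ACR.fromCommutativeRing R

    ℤ⟶ring : ℤ.+-*-rawRing ACR.-Raw-AlmostCommutative⟶ almostRing
    ℤ⟶ring = record
      { ⟦_⟧ = ⟦_⟧ ; +-homo = +-homo ; *-homo = *-homo ; -‿homo = -‿homo
      ; 0-homo = refl ; 1-homo = refl }

    ≟-coefficients : ∀ i j → Maybe (⟦ i ⟧ ≈ ⟦ j ⟧)
    ≟-coefficients i j with i ℤ.≟ j
    ... | yes ≡.refl = just refl
    ... | no _       = nothing

  open import Algebra.Solver.Ring ℤ.+-*-rawRing almostRing ℤ⟶ring ≟-coefficients public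
    using (solve; _:=_; _:+_; _:*_; :-_; _:-_; con)

module FieldProperties (K : Field) where

  open Field K hiding (zero)
  open LinAlg K
  open IntegerRingSolver commutativeRing
  open import Relation.Binary.Reasoning.Setoid setoid
  open import Algebra.Properties.AbelianGroup +-abelianGroup
    using (⁻¹-∙-comm; ε⁻¹≈ε; inverseʳ-unique; x∙y⁻¹≈ε⇒x≈y) public
  open import Algebra.Properties.CommutativeSemigroup *-commutativeSemigroup
    using (x∙yz≈y∙xz; xy∙z≈y∙xz) public
  import Algebra.Properties.Semiring.Sum semiring as Sum
  open import Algebra.Properties.Semiring.Exp semiring using (_^_)

  1≉0 : ¬ 1# ≈ 0#
  1≉0 1≈0 = 0≉1 (sym 1≈0)

  _⁻¹[_] : ∀ x → ¬ x ≈ 0# → Carrier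
  x ⁻¹[ x≉0 ] = proj₁ (inverse x x≉0)

  x*x⁻¹≈1 : ∀ x (x≉0 : ¬ x ≈ 0#) → x * x ⁻¹[ x≉0 ] ≈ 1#
  x*x⁻¹≈1 x x≉0 = proj₂ (inverse x x≉0)

  xy≈0⇒y≈0 : ∀ {x y} → ¬ x ≈ 0# → x * y ≈ 0# → y ≈ 0#
  xy≈0⇒y≈0 {x} {y} x≉0 xy≈0 = begin
    y                         ≈⟨ *-identityˡ y ⟨
    1# * y                    ≈⟨ *-congʳ (x*x⁻¹≈1 x x≉0) ⟨
    (x * x ⁻¹[ x≉0 ]) * y     ≈⟨ xy∙z≈y∙xz x _ y ⟩
    x ⁻¹[ x≉0 ] * (x * y)     ≈⟨ *-congˡ xy≈0 ⟩
    x ⁻¹[ x≉0 ] * 0#          ≈⟨ zeroʳ _ ⟩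
    0#                        ∎

  *-≉0 : ∀ {x y} → ¬ x ≈ 0# → ¬ y ≈ 0# → ¬ x * y ≈ 0#
  *-≉0 x≉0 y≉0 xy≈0 = y≉0 (xy≈0⇒y≈0 x≉0 xy≈0)

  0^n≈0 : ∀ {n} → 0 < n → 0# ^ n ≈ 0#
  0^n≈0 {suc n} _ = zeroˡ (0# ^ n)

  sumFin≡sum : ∀ {d} (f : Fin d → Carrier) → sumFin f ≡ Sum.sum f
  sumFin≡sum {zero}  f = ≡.refl
  sumFin≡sum {suc d} f = ≡.cong (f zero +_) (sumFin≡sum (λ i → f (suc i)))

  sumFin-cong : ∀ {d} {f g : Fin d → Carrier} → (∀ i → f i ≈ g i) → sumFin f ≈ sumFin g
  sumFin-cong {f = f} {g} f≈g rewrite sumFin≡sum f | sumFin≡sum g = Sum.sum-cong-≋ f≈g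

  sumFin-zero : ∀ {d} {f : Fin d → Carrier} → (∀ i → f i ≈ 0#) → sumFin f ≈ 0#
  sumFin-zero {d} {f} f≈0 rewrite sumFin≡sum f = trans (Sum.sum-cong-≋ f≈0) (Sum.sum-replicate-zero d)

  sumFin-+ : ∀ {d} (f g : Fin d → Carrier) → sumFin (λ i → f i + g i) ≈ sumFin f + sumFin g
  sumFin-+ f g rewrite sumFin≡sum (λ i → f i + g i) | sumFin≡sum f | sumFin≡sum g = Sum.∑-distrib-+ f g

  *-distribˡ-sumFin : ∀ {d} x (f : Fin d → Carrier) → x * sumFin f ≈ sumFin (λ i → x * f i)
  *-distribˡ-sumFin x f rewrite sumFin≡sum f | sumFin≡sum (λ i → x * f i) = Sum.*-distribˡ-sum x f

  *-distribʳ-sumFin : ∀ {d} x (f : Fin d → Carrier) → sumFin f * x ≈ sumFin (λ i → f i * x)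
  *-distribʳ-sumFin x f rewrite sumFin≡sum f | sumFin≡sum (λ i → f i * x) = Sum.*-distribʳ-sum x f

  sumFin-comm : ∀ {d e} (f : Fin d → Fin e → Carrier) →
                sumFin (λ i → sumFin (f i)) ≈ sumFin (λ j → sumFin (λ i → f i j))
  sumFin-comm {d} {e} f = begin
    sumFin (λ i → sumFin (f i))                  ≡⟨ sumFin≡sum (λ i → sumFin (f i)) ⟩
    Sum.sum (λ i → sumFin (f i))                 ≡⟨ Sum.sum-cong-≗ (λ i → sumFin≡sum (f i)) ⟩
    Sum.sum (λ i → Sum.sum (f i))                ≈⟨ Sum.∑-comm f ⟩
    Sum.sum (λ j → Sum.sum (λ i → f i j))        ≡⟨ Sum.sum-cong-≗ (λ j → sumFin≡sum (λ i → f i j)) ⟨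
    Sum.sum (λ j → sumFin (λ i → f i j))         ≡⟨ sumFin≡sum (λ j → sumFin (λ i → f i j)) ⟨
    sumFin (λ j → sumFin (λ i → f i j))          ∎

  sumFin-remove : ∀ {d} (i : Fin (suc d)) (f : Fin (suc d) → Carrier) →
                  sumFin f ≈ f i + sumFin (λ j → f (Fin.punchIn i j))
  sumFin-remove i f rewrite sumFin≡sum f | sumFin≡sum (λ j → f (Fin.punchIn i j)) = Sum.sum-remove f

  -‿sumFin : ∀ {d} (f : Fin d → Carrier) → - sumFin f ≈ sumFin (λ i → - f i)
  -‿sumFin {zero}  f = ε⁻¹≈ε
  -‿sumFin {suc d} f = trans (sym (⁻¹-∙-comm _ _)) (+-congˡ (-‿sumFin (λ i → f (suc i))))

  sumFin-sub : ∀ {d} (f g : Fin d → Carrier) → sumFin (λ i → f i - g i) ≈ sumFin f - sumFin g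
  sumFin-sub f g = trans (sumFin-+ f (λ i → - g i)) (+-congˡ (sym (-‿sumFin g)))

  sumFin-exchange : ∀ {d e} (a : Fin d → Carrier) (b : Fin e → Carrier) (M : Fin d → Fin e → Carrier) →
                    sumFin (λ i → a i * sumFin (λ j → b j * M i j)) ≈ sumFin (λ j → b j * sumFin (λ i → a i * M i j))
  sumFin-exchange a b M = begin
    sumFin (λ i → a i * sumFin (λ j → b j * M i j))    ≈⟨ sumFin-cong (λ i → *-distribˡ-sumFin (a i) (λ j → b j * M i j)) ⟩
    sumFin (λ i → sumFin (λ j → a i * (b j * M i j)))  ≈⟨ sumFin-comm (λ i j → a i * (b j * M i j)) ⟩
    sumFin (λ j → sumFin (λ i → a i * (b j * M i j)))  ≈⟨ sumFin-cong (λ j → sumFin-cong (λ i → x∙yz≈y∙xz (a i) (b j) (M i j))) ⟩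
    sumFin (λ j → sumFin (λ i → b j * (a i * M i j)))  ≈⟨ sumFin-cong (λ j → *-distribˡ-sumFin (b j) (λ i → a i * M i j)) ⟨
    sumFin (λ j → b j * sumFin (λ i → a i * M i j))    ∎

  δ : ∀ {d} → Fin d → Fin d → Carrier
  δ zero    zero    = 1#
  δ zero    (suc j) = 0#
  δ (suc i) zero    = 0#
  δ (suc i) (suc j) = δ i j

  δ-comm : ∀ {d} (i j : Fin d) → δ i j ≡ δ j i
  δ-comm zero    zero    = ≡.refl
  δ-comm zero    (suc j) = ≡.refl
  δ-comm (suc i) zero    = ≡.refl
  δ-comm (suc i) (suc j) = δ-comm i j

  δ-refl : ∀ {d} (i : Fin d) → δ i i ≡ 1#
  δ-refl zero    = ≡.refl
  δ-refl (suc i) = δ-refl i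

  δ-≢ : ∀ {d} {i j : Fin d} → i ≢ j → δ i j ≈ 0#
  δ-≢ {i = zero}  {zero}  i≢j = ⊥-elim (i≢j ≡.refl)
  δ-≢ {i = zero}  {suc j} i≢j = refl
  δ-≢ {i = suc i} {zero}  i≢j = refl
  δ-≢ {i = suc i} {suc j} i≢j = δ-≢ (λ i≡j → i≢j (≡.cong suc i≡j))

  δ-injective : ∀ {d e} {f : Fin d → Fin e} → (∀ {i j} → f i ≡ f j → i ≡ j) →
                ∀ i j → δ (f i) (f j) ≈ δ i j
  δ-injective {f = f} f-inj i j with i Fin.≟ j
  ... | yes ≡.refl = reflexive (≡.trans (δ-refl (f i)) (≡.sym (δ-refl i)))
  ... | no i≢j     = trans (δ-≢ (λ fi≡fj → i≢j (f-inj fi≡fj))) (sym (δ-≢ i≢j))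

  sumFin-δˡ : ∀ {d} (i : Fin d) (f : Fin d → Carrier) → sumFin (λ j → δ i j * f j) ≈ f i
  sumFin-δˡ zero f = begin
    1# * f zero + sumFin (λ j → 0# * f (suc j))  ≈⟨ +-cong (*-identityˡ _) (sumFin-zero (λ j → zeroˡ (f (suc j)))) ⟩
    f zero + 0#                                  ≈⟨ +-identityʳ _ ⟩
    f zero                                       ∎
  sumFin-δˡ (suc i) f = begin
    0# * f zero + sumFin (λ j → δ i j * f (suc j))  ≈⟨ +-cong (zeroˡ _) (sumFin-δˡ i (λ j → f (suc j))) ⟩
    0# + f (suc i)                                  ≈⟨ +-identityˡ _ ⟩
    f (suc i)                                       ∎

  sumFin-δʳ : ∀ {d} (i : Fin d) (f : Fin d → Carrier) → sumFin (λ j → f j * δ j i) ≈ f i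
  sumFin-δʳ i f = trans (sumFin-cong (λ j → trans (*-comm (f j) _) (*-congʳ (reflexive (δ-comm j i))))) (sumFin-δˡ i f)

  unit : ∀ {s} → Fin s → Vect (Fin s)
  unit = δ

  lincomb-cong : ∀ {I d} {c c′ : Fin d → Carrier} {v w : Fin d → Vect I} →
                 (∀ a → c a ≈ c′ a) → (∀ a → v a ≈v w a) → lincomb c v ≈v lincomb c′ w
  lincomb-cong c≈c′ v≈w i = sumFin-cong (λ a → *-cong (c≈c′ a) (v≈w a i))

  lincomb-zero : ∀ {I d} {c : Fin d → Carrier} (v : Fin d → Vect I) → (∀ a → c a ≈ 0#) → lincomb c v ≈v 0v
  lincomb-zero v c≈0 i = sumFin-zero (λ a → trans (*-congʳ (c≈0 a)) (zeroˡ (v a i)))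

  lincomb-lincomb : ∀ {I t e} (c : Fin t → Carrier) (M : Fin t → Fin e → Carrier) (E : Fin e → Vect I) →
                    lincomb c (λ a → lincomb (M a) E) ≈v lincomb (λ j → sumFin (λ a → c a * M a j)) E
  lincomb-lincomb c M E i = begin
    sumFin (λ a → c a * sumFin (λ j → M a j * E j i))    ≈⟨ sumFin-cong (λ a → *-distribˡ-sumFin (c a) (λ j → M a j * E j i)) ⟩
    sumFin (λ a → sumFin (λ j → c a * (M a j * E j i)))  ≈⟨ sumFin-comm (λ a j → c a * (M a j * E j i)) ⟩
    sumFin (λ j → sumFin (λ a → c a * (M a j * E j i)))  ≈⟨ sumFin-cong (λ j → sumFin-cong (λ a → sym (*-assoc (c a) (M a j) (E j i)))) ⟩
    sumFin (λ j → sumFin (λ a → c a * M a j * E j i))    ≈⟨ sumFin-cong (λ j → sym (*-distribʳ-sumFin (E j i) (λ a → c a * M a j))) ⟩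
    sumFin (λ j → sumFin (λ a → c a * M a j) * E j i)    ∎

  lincomb-unit : ∀ {s} (c : Vect (Fin s)) → lincomb c unit ≈v c
  lincomb-unit c i = sumFin-δʳ i c

  unit-independent : ∀ {s} → LinIndep (unit {s})
  unit-independent c c·e≈0 a = trans (sym (lincomb-unit c a)) (c·e≈0 a)

  ∈-Span : ∀ {I d} (u : Fin d → Vect I) (a : Fin d) → Span u (u a)
  ∈-Span u a = δ a , (λ i → sym (sumFin-δˡ a (λ j → u j i)))

  Span-zero : ∀ {I} {E : Fin 0 → Vect I} x → Span E x → x ≈v 0v
  Span-zero x (c , x≈0) = x≈0

  lincomb-closed : ∀ {I} (S : Subspace I) {d} (c : Fin d → Carrier) (v : Fin d → Vect I) →
                   (∀ a → mem S (v a)) → mem S (lincomb c v)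
  lincomb-closed S {zero}  c v v∈S = has0 S
  lincomb-closed S {suc d} c v v∈S =
    closed+ S (closed· S (c zero) (v∈S zero)) (lincomb-closed S (λ j → c (suc j)) (λ j → v (suc j)) (λ j → v∈S (suc j)))

  spanSubspace : ∀ {I d} (v : Fin d → Vect I) → Subspace I
  spanSubspace v = record
    { mem     = Span v
    ; resp    = λ x≈y (c , x≈cv) → c , (λ i → trans (sym (x≈y i)) (x≈cv i))
    ; has0    = (λ _ → 0#) , (λ i → sym (lincomb-zero v (λ _ → refl) i))
    ; closed+ = λ (c , x≈cv) (c′ , y≈c′v) → (λ a → c a + c′ a) ,
                  (λ i → trans (+-cong (x≈cv i) (y≈c′v i))
                               (sym (trans (sumFin-cong (λ a → distribʳ (v a i) (c a) (c′ a)))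
                                           (sumFin-+ (λ a → c a * v a i) (λ a → c′ a * v a i)))))
    ; closed· = λ k (c , x≈cv) → (λ a → k * c a) ,
                  (λ i → trans (*-congˡ (x≈cv i))
                               (trans (*-distribˡ-sumFin k (λ a → c a * v a i)) (sumFin-cong (λ a → sym (*-assoc k (c a) (v a i))))))
    }

  span-HasDim : ∀ {I d} (u : Fin d → Vect I) → LinIndep u → HasDim (Span u) d
  span-HasDim u u-ind = u , ∈-Span u , u-ind , (λ x x∈ → x∈)

  independent⇒≉0 : ∀ {I d} (u : Fin d → Vect I) → LinIndep u → ∀ a → ¬ u a ≈v 0v
  independent⇒≉0 u u-ind a ua≈0 = 1≉0 (trans (reflexive (≡.sym (δ-refl a))) (u-ind (δ a) δa·u≈0 a))
    where
    δa·u≈0 : lincomb (δ a) u ≈v 0v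
    δa·u≈0 i = trans (sumFin-δˡ a (λ j → u j i)) (ua≈0 i)

  independent-punchIn : ∀ {I d} (u : Fin (suc d) → Vect I) → LinIndep u →
    (a₀ : Fin (suc d)) (t : Carrier) (β : Fin d → Carrier) →
    (∀ i → t * u a₀ i + sumFin (λ b → β b * u (Fin.punchIn a₀ b) i) ≈ 0#) → ∀ b → β b ≈ 0#
  independent-punchIn u u-ind a₀ t β ≈0 b =
    trans (reflexive (≡.sym (VecF.insertAt-punchIn β a₀ t b))) (u-ind ξ ξ·u≈0 (Fin.punchIn a₀ b))
    where
    ξ : Fin _ → Carrier
    ξ = Vec.insertAt β a₀ t
    ξ·u≈0 : lincomb ξ u ≈v 0v
    ξ·u≈0 i = begin
      sumFin (λ a → ξ a * u a i)                                            ≈⟨ sumFin-remove a₀ (λ a → ξ a * u a i) ⟩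
      ξ a₀ * u a₀ i + sumFin (λ b → ξ (Fin.punchIn a₀ b) * u (Fin.punchIn a₀ b) i)
        ≈⟨ +-cong (*-congʳ (reflexive (VecF.insertAt-lookup β a₀ t)))
                  (sumFin-cong (λ b → *-congʳ (reflexive (VecF.insertAt-punchIn β a₀ t b)))) ⟩
      t * u a₀ i + sumFin (λ b → β b * u (Fin.punchIn a₀ b) i)              ≈⟨ ≈0 i ⟩
      0#                                                                    ∎

  dot-comm : ∀ {s} (x y : Vect (Fin s)) → dot x y ≈ dot y x
  dot-comm x y = sumFin-cong (λ i → *-comm (x i) (y i))

  dot-congˡ : ∀ {s} {x x′ : Vect (Fin s)} (y : Vect (Fin s)) → x ≈v x′ → dot x y ≈ dot x′ y
  dot-congˡ y x≈x′ = sumFin-cong (λ i → *-congʳ (x≈x′ i))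

  dot-congʳ : ∀ {s} (x : Vect (Fin s)) {y y′ : Vect (Fin s)} → y ≈v y′ → dot x y ≈ dot x y′
  dot-congʳ x y≈y′ = sumFin-cong (λ i → *-congˡ (y≈y′ i))

  dot-+ʳ : ∀ {s} (x u v : Vect (Fin s)) → dot x (u +v v) ≈ dot x u + dot x v
  dot-+ʳ x u v = trans (sumFin-cong (λ i → distribˡ (x i) (u i) (v i))) (sumFin-+ (λ i → x i * u i) (λ i → x i * v i))

  dot-zeroˡ : ∀ {s} {x : Vect (Fin s)} (y : Vect (Fin s)) → x ≈v 0v → dot x y ≈ 0#
  dot-zeroˡ y x≈0 = sumFin-zero (λ i → trans (*-congʳ (x≈0 i)) (zeroˡ (y i)))

  dot-unitʳ : ∀ {s} (x : Vect (Fin s)) (i : Fin s) → dot x (unit i) ≈ x i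
  dot-unitʳ x i = trans (sumFin-cong (λ j → *-congˡ (reflexive (δ-comm i j)))) (sumFin-δʳ i x)

  dot-lincombʳ : ∀ {s d} (x : Vect (Fin s)) (c : Fin d → Carrier) (v : Fin d → Vect (Fin s)) →
                 dot x (lincomb c v) ≈ sumFin (λ j → c j * dot x (v j))
  dot-lincombʳ x c v = sumFin-exchange x c (λ i j → v j i)

  dot-lincombˡ : ∀ {s d} (c : Fin d → Carrier) (v : Fin d → Vect (Fin s)) (y : Vect (Fin s)) →
                 dot (lincomb c v) y ≈ sumFin (λ j → c j * dot (v j) y)
  dot-lincombˡ c v y = trans (dot-comm (lincomb c v) y)
    (trans (dot-lincombʳ y c v) (sumFin-cong (λ j → *-congˡ (dot-comm y (v j)))))

  Span-orthogonal : ∀ {s d e} (X : Fin d → Vect (Fin s)) (Y : Fin e → Vect (Fin s)) →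
    (∀ j l → dot (X j) (Y l) ≈ 0#) → ∀ x → Span X x → ∀ y → Span Y y → dot x y ≈ 0#
  Span-orthogonal X Y X⊥Y x (α , x≈αX) y (β , y≈βY) = begin
    dot x y                                       ≈⟨ dot-congˡ y x≈αX ⟩
    dot (lincomb α X) y                           ≈⟨ dot-congʳ (lincomb α X) y≈βY ⟩
    dot (lincomb α X) (lincomb β Y)               ≈⟨ dot-lincombˡ α X (lincomb β Y) ⟩
    sumFin (λ j → α j * dot (X j) (lincomb β Y))  ≈⟨ sumFin-zero (λ j → trans (*-congˡ (Xj⊥βY j)) (zeroʳ (α j))) ⟩
    0#                                            ∎
    where
    Xj⊥βY : ∀ j → dot (X j) (lincomb β Y) ≈ 0#
    Xj⊥βY j = trans (dot-lincombʳ (X j) β Y) (sumFin-zero (λ l → trans (*-congˡ (X⊥Y j l)) (zeroʳ (β l))))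

  dot-sub : ∀ {s} (φ x y : Vect (Fin s)) k → dot φ (λ i → x i - k * y i) ≈ dot φ x - k * dot φ y
  dot-sub φ x y k = begin
    sumFin (λ i → φ i * (x i - k * y i))           ≈⟨ sumFin-cong (λ i → distrib-sub (φ i) (x i) (y i)) ⟩
    sumFin (λ i → φ i * x i - k * (φ i * y i))     ≈⟨ sumFin-sub (λ i → φ i * x i) (λ i → k * (φ i * y i)) ⟩
    dot φ x - sumFin (λ i → k * (φ i * y i))       ≈⟨ +-congˡ (-‿cong (*-distribˡ-sumFin k (λ i → φ i * y i))) ⟨
    dot φ x - k * dot φ y                          ∎
    where
    distrib-sub : ∀ a b c → a * (b - k * c) ≈ a * b - k * (a * c)
    distrib-sub a b c = solve 4 (λ a b c k → a :* (b :- k :* c) := a :* b :- k :* (a :* c)) refl a b c k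

  sumFin-↑ : ∀ {a b} (f : Fin (a +ℕ b) → Carrier) →
             sumFin f ≈ sumFin (λ i → f (i ↑ˡ b)) + sumFin (λ j → f (a ↑ʳ j))
  sumFin-↑ {zero}  f = sym (+-identityˡ _)
  sumFin-↑ {suc a} {b} f = trans (+-congˡ (sumFin-↑ {a} {b} (λ i → f (suc i)))) (sym (+-assoc _ _ _))

  lincomb-++ : ∀ {I a b} (c : Fin (a +ℕ b) → Carrier) (v : Fin a → Vect I) (w : Fin b → Vect I) →
               lincomb c (v Vec.++ w) ≈v (lincomb (λ i → c (i ↑ˡ b)) v +v lincomb (λ j → c (a ↑ʳ j)) w)
  lincomb-++ {a = a} {b} c v w p = trans (sumFin-↑ {a} {b} (λ j → c j * (v Vec.++ w) j p))
    (+-cong (sumFin-cong (λ i → *-congˡ (reflexive (≡.cong (λ x → x p) (VecF.lookup-++ˡ v w i)))))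
            (sumFin-cong (λ j → *-congˡ (reflexive (≡.cong (λ x → x p) (VecF.lookup-++ʳ v w j))))))

  ++-independent : ∀ {I a b} (v : Fin a → Vect I) (w : Fin b → Vect I) → LinIndep v →
                   (∀ cv cw → (lincomb cv v +v lincomb cw w) ≈v 0v → ∀ j → cw j ≈ 0#) →
                   LinIndep (v Vec.++ w)
  ++-independent {a = a} {b} v w v-ind w-part c c·vw≈0 j with ↑ˡ-or-↑ʳ {a} {b} j
  ... | inj₁ (i , ≡.refl) = v-ind cv cv·v≈0 i
    where
    cv : Fin a → Carrier
    cv i = c (i ↑ˡ b)
    cv·v≈0 : lincomb cv v ≈v 0v
    cv·v≈0 p = begin
      lincomb cv v p                                          ≈⟨ +-identityʳ _ ⟨
      lincomb cv v p + 0#                                     ≈⟨ +-congˡ (lincomb-zero w (w-part cv _ sum≈0) p) ⟨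
      lincomb cv v p + lincomb (λ j → c (a ↑ʳ j)) w p         ≈⟨ sum≈0 p ⟩
      0#                                                      ∎
      where
      sum≈0 : (lincomb cv v +v lincomb (λ j → c (a ↑ʳ j)) w) ≈v 0v
      sum≈0 p = trans (sym (lincomb-++ c v w p)) (c·vw≈0 p)
  ... | inj₂ (i , ≡.refl) = w-part _ _ (λ p → trans (sym (lincomb-++ c v w p)) (c·vw≈0 p)) i

  trivial⇒HasDim-0 : ∀ {I} {S : Pred I} {e} → HasDim S e → (∀ x → S x → x ≈v 0v) → e ≡ 0
  trivial⇒HasDim-0 {e = zero}  _                      S≈0 = ≡.refl
  trivial⇒HasDim-0 {e = suc e} (E , E∈S , E-ind , _)  S≈0 = ⊥-elim (independent⇒≉0 E E-ind zero (S≈0 (E zero) (E∈S zero)))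

  HasDim-0⇒trivial : ∀ {I} {S : Pred I} {e} → HasDim S e → e ≡ 0 → ∀ x → S x → x ≈v 0v
  HasDim-0⇒trivial (E , _ , _ , S⊆span) ≡.refl x x∈S = Span-zero {E = E} x (S⊆span x x∈S)

module LinearSystems (K : Field) (≈0? : ∀ x → Dec (Field._≈_ K x (Field.0# K))) where

  open Field K hiding (zero)
  open LinAlg K
  open FieldProperties K
  open IntegerRingSolver commutativeRing
  open import Relation.Binary.Reasoning.Setoid setoid
  open import Data.Fin using (punchIn)

  Kernel : ∀ {s c} → (Fin c → Vect (Fin s)) → Pred (Fin s)
  Kernel φ x = ∀ l → dot (φ l) x ≈ 0#

  record KernelBasis {s c} (φ : Fin c → Vect (Fin s)) : Set where
    field
      dim          : ℕ
      basis        : Fin dim → Vect (Fin s)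
      rank-nullity : s ≤ dim +ℕ c
      independent  : LinIndep basis
      basis⊆kernel : ∀ a → Kernel φ (basis a)
      kernel⊆span  : Kernel φ ⊆ Span basis

  module Pivot {s d} (ψ : Vect (Fin s)) (u : Fin (suc d) → Vect (Fin s)) (a₀ : Fin (suc d))
               (ψu₀≉0 : ¬ dot ψ (u a₀) ≈ 0#) where

    α : Fin (suc d) → Carrier
    α a = dot ψ (u a)

    α₀⁻¹ : Carrier
    α₀⁻¹ = α a₀ ⁻¹[ ψu₀≉0 ]

    κ : Fin d → Carrier
    κ b = α (punchIn a₀ b) * α₀⁻¹

    reduced : Fin d → Vect (Fin s)
    reduced b i = u (punchIn a₀ b) i - κ b * u a₀ i

    reduced-∈-kernelψ : ∀ b → dot ψ (reduced b) ≈ 0#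
    reduced-∈-kernelψ b = begin
      dot ψ (reduced b)            ≈⟨ dot-sub ψ (u (punchIn a₀ b)) (u a₀) (κ b) ⟩
      αb - (αb * α₀⁻¹) * α a₀      ≈⟨ +-congˡ (-‿cong (trans (*-assoc αb α₀⁻¹ (α a₀)) (*-congˡ (*-comm α₀⁻¹ (α a₀))))) ⟩
      αb - αb * (α a₀ * α₀⁻¹)      ≈⟨ +-congˡ (-‿cong (*-congˡ (x*x⁻¹≈1 (α a₀) ψu₀≉0))) ⟩
      αb - αb * 1#                 ≈⟨ +-congˡ (-‿cong (*-identityʳ αb)) ⟩
      αb - αb                      ≈⟨ -‿inverseʳ αb ⟩
      0#                           ∎
      where
      αb : Carrier
      αb = α (punchIn a₀ b)

    reduced-∈-kernel : ∀ φ → (∀ a → dot φ (u a) ≈ 0#) → ∀ b → dot φ (reduced b) ≈ 0#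
    reduced-∈-kernel φ φu≈0 b = begin
      dot φ (reduced b)                                   ≈⟨ dot-sub φ (u (punchIn a₀ b)) (u a₀) (κ b) ⟩
      dot φ (u (punchIn a₀ b)) - κ b * dot φ (u a₀)       ≈⟨ +-cong (φu≈0 _) (-‿cong (trans (*-congˡ (φu≈0 a₀)) (zeroʳ (κ b)))) ⟩
      0# - 0#                                             ≈⟨ -‿inverseʳ 0# ⟩
      0#                                                  ∎

    lincomb-reduced : ∀ β i → lincomb β reduced i ≈
                      sumFin (λ b → β b * u (punchIn a₀ b) i) - sumFin (λ b → β b * κ b) * u a₀ i
    lincomb-reduced β i = begin
      sumFin (λ b → β b * (u (punchIn a₀ b) i - κ b * u a₀ i))
        ≈⟨ sumFin-cong (λ b → distrib-sub (β b) (u (punchIn a₀ b) i) (κ b)) ⟩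
      sumFin (λ b → β b * u (punchIn a₀ b) i - β b * κ b * u a₀ i)
        ≈⟨ sumFin-sub (λ b → β b * u (punchIn a₀ b) i) (λ b → β b * κ b * u a₀ i) ⟩
      sumFin (λ b → β b * u (punchIn a₀ b) i) - sumFin (λ b → β b * κ b * u a₀ i)
        ≈⟨ +-congˡ (-‿cong (*-distribʳ-sumFin (u a₀ i) (λ b → β b * κ b))) ⟨
      sumFin (λ b → β b * u (punchIn a₀ b) i) - sumFin (λ b → β b * κ b) * u a₀ i ∎
      where
      distrib-sub : ∀ b x k → b * (x - k * u a₀ i) ≈ b * x - b * k * u a₀ i
      distrib-sub b x k = solve 4 (λ b x k y → b :* (x :- k :* y) := b :* x :- b :* k :* y) refl b x k (u a₀ i)

    reduced-independent : LinIndep u → LinIndep reduced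
    reduced-independent u-ind β β·reduced≈0 = independent-punchIn u u-ind a₀ (- T) β eliminated
      where
      T : Carrier
      T = sumFin (λ b → β b * κ b)
      eliminated : ∀ i → - T * u a₀ i + sumFin (λ b → β b * u (punchIn a₀ b) i) ≈ 0#
      eliminated i = begin
        - T * u a₀ i + S                    ≈⟨ solve 3 (λ T y S → :- T :* y :+ S := S :- T :* y) refl T (u a₀ i) S ⟩
        S - T * u a₀ i                      ≈⟨ lincomb-reduced β i ⟨
        lincomb β reduced i                 ≈⟨ β·reduced≈0 i ⟩
        0#                                  ∎
        where
        S : Carrier
        S = sumFin (λ b → β b * u (punchIn a₀ b) i)

    reduced-spans : ∀ x → Span u x → dot ψ x ≈ 0# → Span reduced x
    reduced-spans x (β , x≈βu) ψx≈0 = β′ , x≈β′reduced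
      where
      β′ : Fin d → Carrier
      β′ b = β (punchIn a₀ b)
      S : Carrier
      S = sumFin (λ b → β′ b * α (punchIn a₀ b))
      β₀α₀+S≈0 : β a₀ * α a₀ + S ≈ 0#
      β₀α₀+S≈0 = begin
        β a₀ * α a₀ + S                    ≈⟨ sumFin-remove a₀ (λ a → β a * α a) ⟨
        sumFin (λ a → β a * α a)           ≈⟨ dot-lincombʳ ψ β u ⟨
        dot ψ (lincomb β u)                ≈⟨ dot-congʳ ψ x≈βu ⟨
        dot ψ x                            ≈⟨ ψx≈0 ⟩
        0#                                 ∎
      β′κ≈-β₀ : sumFin (λ b → β′ b * κ b) ≈ - β a₀
      β′κ≈-β₀ = begin
        sumFin (λ b → β′ b * (α (punchIn a₀ b) * α₀⁻¹))  ≈⟨ sumFin-cong (λ b → sym (*-assoc (β′ b) _ α₀⁻¹)) ⟩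
        sumFin (λ b → β′ b * α (punchIn a₀ b) * α₀⁻¹)    ≈⟨ *-distribʳ-sumFin α₀⁻¹ (λ b → β′ b * α (punchIn a₀ b)) ⟨
        S * α₀⁻¹                                        ≈⟨ *-congʳ (inverseʳ-unique _ _ β₀α₀+S≈0) ⟩
        - (β a₀ * α a₀) * α₀⁻¹
          ≈⟨ solve 3 (λ b a i → :- (b :* a) :* i := :- (b :* (a :* i))) refl (β a₀) (α a₀) α₀⁻¹ ⟩
        - (β a₀ * (α a₀ * α₀⁻¹))                        ≈⟨ -‿cong (*-congˡ (x*x⁻¹≈1 (α a₀) ψu₀≉0)) ⟩
        - (β a₀ * 1#)                                   ≈⟨ -‿cong (*-identityʳ (β a₀)) ⟩
        - β a₀                                          ∎
      x≈β′reduced : x ≈v lincomb β′ reduced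
      x≈β′reduced i = begin
        x i                                 ≈⟨ x≈βu i ⟩
        sumFin (λ a → β a * u a i)          ≈⟨ sumFin-remove a₀ (λ a → β a * u a i) ⟩
        β a₀ * u a₀ i + P                   ≈⟨ solve 3 (λ b y P → b :* y :+ P := P :- (:- b) :* y) refl (β a₀) (u a₀ i) P ⟩
        P - (- β a₀) * u a₀ i               ≈⟨ +-congˡ (-‿cong (*-congʳ β′κ≈-β₀)) ⟨
        P - sumFin (λ b → β′ b * κ b) * u a₀ i ≈⟨ lincomb-reduced β′ i ⟨
        lincomb β′ reduced i                ∎
        where
        P : Carrier
        P = sumFin (λ b → β′ b * u (punchIn a₀ b) i)

  private
    extend-by-pivot : ∀ {s c} (φ : Fin (suc c) → Vect (Fin s)) (kb : KernelBasis (λ l → φ (suc l))) →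
                      (a₀ : Fin (KernelBasis.dim kb)) → ¬ dot (φ zero) (KernelBasis.basis kb a₀) ≈ 0# →
                      KernelBasis φ
    extend-by-pivot {s} {c} φ record { dim = suc d ; basis = u ; rank-nullity = s≤ ; independent = u-ind
                                     ; basis⊆kernel = u⊆ker ; kernel⊆span = ker⊆span } a₀ ψu₀≉0 = record
      { dim          = d
      ; basis        = reduced
      ; rank-nullity = ≡.subst (s ≤_) (≡.sym (ℕ.+-suc d c)) s≤
      ; independent  = reduced-independent u-ind
      ; basis⊆kernel = λ where b zero    → reduced-∈-kernelψ b
                               b (suc l) → reduced-∈-kernel (φ (suc l)) (λ a → u⊆ker a l) b
      ; kernel⊆span  = λ x φx≈0 → reduced-spans x (ker⊆span x (λ l → φx≈0 (suc l))) (φx≈0 zero)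
      }
      where open Pivot (φ zero) u a₀ ψu₀≉0

    extend-without-pivot : ∀ {s c} (φ : Fin (suc c) → Vect (Fin s)) (kb : KernelBasis (λ l → φ (suc l))) →
                           (∀ a → dot (φ zero) (KernelBasis.basis kb a) ≈ 0#) → KernelBasis φ
    extend-without-pivot {c = c} φ kb φ₀u≈0 = record
      { dim          = dim
      ; basis        = basis
      ; rank-nullity = ℕ.≤-trans rank-nullity (ℕ.+-monoʳ-≤ dim (ℕ.n≤1+n c))
      ; independent  = independent
      ; basis⊆kernel = λ where a zero    → φ₀u≈0 a
                               a (suc l) → basis⊆kernel a l
      ; kernel⊆span  = λ x φx≈0 → kernel⊆span x (λ l → φx≈0 (suc l))
      }
      where open KernelBasis kb

  kernelBasis : ∀ {s c} (φ : Fin c → Vect (Fin s)) → KernelBasis φ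
  kernelBasis {s} {zero} φ = record
    { dim          = s
    ; basis        = unit
    ; rank-nullity = ℕ.m≤m+n s 0
    ; independent  = unit-independent
    ; basis⊆kernel = λ a ()
    ; kernel⊆span  = λ x _ → x , (λ i → sym (lincomb-unit x i))
    }
  kernelBasis {s} {suc c} φ with kernelBasis (λ l → φ (suc l))
  ... | kb with Finₚ.any? (λ a → ¬? (≈0? (dot (φ zero) (KernelBasis.basis kb a))))
  ...   | yes (a₀ , ψu₀≉0) = extend-by-pivot φ kb a₀ ψu₀≉0
  ...   | no  no-pivot     = extend-without-pivot φ kb
                               (λ a → decidable-stable (≈0? _) (λ ψua≉0 → no-pivot (a , ψua≉0)))

  kernel-nontrivial : ∀ {s c} (φ : Fin c → Vect (Fin s)) → c < s → ∃[ x ] Kernel φ x × ¬ x ≈v 0v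
  kernel-nontrivial {s} {c} φ c<s with kernelBasis φ
  ... | record { dim = zero ; rank-nullity = s≤c } = contradiction s≤c (ℕ.<⇒≱ c<s)
  ... | record { dim = suc d ; basis = u ; independent = u-ind ; basis⊆kernel = u⊆ker } =
    u zero , u⊆ker zero , independent⇒≉0 u u-ind zero

  independent-≤ : ∀ {I t e} (v : Fin t → Vect I) (E : Fin e → Vect I) → LinIndep v →
                  (∀ a → Span E (v a)) → t ≤ e
  independent-≤ {t = t} {e} v E v-ind v⊆E = ℕ.≮⇒≥ e≮t
    where
    M : Fin t → Fin e → Carrier
    M a = proj₁ (v⊆E a)
    φ : Fin e → Vect (Fin t)
    φ j a = M a j
    e≮t : ¬ e < t
    e≮t e<t with kernel-nontrivial φ e<t
    ... | c , c∈ker , c≉0 = c≉0 (v-ind c c·v≈0)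
      where
      c·v≈0 : lincomb c v ≈v 0v
      c·v≈0 i = begin
        lincomb c v i                                    ≈⟨ lincomb-cong (λ _ → refl) (λ a → proj₂ (v⊆E a)) i ⟩
        lincomb c (λ a → lincomb (M a) E) i              ≈⟨ lincomb-lincomb c M E i ⟩
        lincomb (λ j → sumFin (λ a → c a * M a j)) E i
          ≈⟨ lincomb-zero E (λ j → trans (sumFin-cong (λ a → *-comm (c a) (M a j))) (c∈ker j)) i ⟩
        0#                                               ∎

  pairIndexed : ∀ {a b s} → (Fin a → Fin b → Vect (Fin s)) → Fin (a *ℕ b) → Vect (Fin s)
  pairIndexed {a} {b} φ idx = φ (proj₁ (Fin.remQuot {a} b idx)) (proj₂ (Fin.remQuot {a} b idx))

  Kernel-pairIndexed⁺ : ∀ {a b s} (φ : Fin a → Fin b → Vect (Fin s)) {x} →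
                        (∀ i j → dot (φ i j) x ≈ 0#) → Kernel (pairIndexed φ) x
  Kernel-pairIndexed⁺ {a} {b} φ φx≈0 idx = φx≈0 (proj₁ (Fin.remQuot {a} b idx)) (proj₂ (Fin.remQuot {a} b idx))

  Kernel-pairIndexed⁻ : ∀ {a b s} (φ : Fin a → Fin b → Vect (Fin s)) {x} →
                        Kernel (pairIndexed φ) x → ∀ i j → dot (φ i j) x ≈ 0#
  Kernel-pairIndexed⁻ {a} {b} φ {x} x∈ker i j =
    ≡.subst (λ (ij : Fin a × Fin b) → dot (φ (proj₁ ij) (proj₂ ij)) x ≈ 0#) (Finₚ.remQuot-combine {a} {b} i j) (x∈ker (Fin.combine i j))

module FiniteField (F : Field) {q : ℕ} (card : HasCard F q) where

  open Field F hiding (zero)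
  open FieldProperties F using (1≉0; xy≈0⇒y≈0; *-≉0; _⁻¹[_]; x*x⁻¹≈1; 0^n≈0)
  open import Relation.Binary.Reasoning.Setoid setoid
  open import Algebra.Definitions.RawMonoid +-rawMonoid using () renaming (_×_ to _·_)
  open import Algebra.Properties.Semiring.Exp semiring using (_^_; ^-congˡ)
  open import Algebra.Properties.AbelianGroup +-abelianGroup
    using (identityʳ-unique; //-rightDividesˡ; //-rightDividesʳ; x∙y⁻¹≈ε⇒x≈y)
  open import Algebra.Properties.Ring ring using (x[y-z]≈xy-xz)
  import Algebra.Properties.CommutativeMonoid.Sum +-commutativeMonoid as Sum
  import Algebra.Properties.CommutativeMonoid.Sum *-commutativeMonoid as Product
  open import Data.Fin.Permutation using (Permutation; permutation; _⟨$⟩ʳ_)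
  open import Function.Bundles using (Bijection)
  open Bijection card using (to; strictlySurjective) renaming (cong to to-cong; injective to to-injective)

  enum : Fin q → Carrier
  enum i = proj₁ (strictlySurjective i)

  to-enum : ∀ i → to (enum i) ≡ i
  to-enum i = proj₂ (strictlySurjective i)

  enum-to : ∀ x → enum (to x) ≈ x
  enum-to x = to-injective (to-enum (to x))

  enum-injective : ∀ {i j} → enum i ≈ enum j → i ≡ j
  enum-injective {i} {j} eq = ≡.trans (≡.sym (to-enum i)) (≡.trans (to-cong eq) (to-enum j))

  ≈0? : ∀ x → Dec (x ≈ 0#)
  ≈0? x with to x Fin.≟ to 0#
  ... | yes eq = yes (to-injective eq)
  ... | no  ne = no (λ x≈0 → ne (to-cong x≈0))

  1<q : 1 < q
  1<q = distinct⇒1< (to 0#) (to 1#) (λ eq → 0≉1 (to-injective eq))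
    where
    distinct⇒1< : ∀ {n} (i j : Fin n) → i ≢ j → 1 < n
    distinct⇒1< {suc zero}    zero zero i≢j = ⊥-elim (i≢j ≡.refl)
    distinct⇒1< {suc (suc n)} _    _    _   = ℕ.s<s ℕ.z<s

  module Relabel (g g⁻¹ : Carrier → Carrier)
                 (g-cong : ∀ {x y} → x ≈ y → g x ≈ g y) (g⁻¹-cong : ∀ {x y} → x ≈ y → g⁻¹ x ≈ g⁻¹ y)
                 (g∘g⁻¹ : ∀ x → g (g⁻¹ x) ≈ x) (g⁻¹∘g : ∀ x → g⁻¹ (g x) ≈ x) where

    π : Permutation q q
    π = permutation (λ i → to (g (enum i))) (λ i → to (g⁻¹ (enum i)))
                    (λ i → ≡.trans (to-cong (trans (g-cong (enum-to _)) (g∘g⁻¹ (enum i)))) (to-enum i))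
                    (λ i → ≡.trans (to-cong (trans (g⁻¹-cong (enum-to _)) (g⁻¹∘g (enum i)))) (to-enum i))

    enum-π : ∀ i → enum (π ⟨$⟩ʳ i) ≈ g (enum i)
    enum-π i = enum-to (g (enum i))

  q·1≈0 : q · 1# ≈ 0#
  q·1≈0 = identityʳ-unique (Sum.sum enum) (q · 1#) (sym shift-invariant)
    where
    open Relabel (_+ 1#) (_- 1#) +-congʳ +-congʳ (//-rightDividesˡ 1#) (//-rightDividesʳ 1#)
    shift-invariant : Sum.sum enum ≈ Sum.sum enum + q · 1#
    shift-invariant = begin
      Sum.sum enum                          ≈⟨ Sum.sum-permute enum π ⟩
      Sum.sum (λ i → enum (π ⟨$⟩ʳ i))       ≈⟨ Sum.sum-cong-≋ enum-π ⟩
      Sum.sum (λ i → enum i + 1#)           ≈⟨ Sum.∑-distrib-+ enum (λ _ → 1#) ⟩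
      Sum.sum enum + Sum.sum {q} (λ _ → 1#) ≈⟨ +-congˡ (Sum.sum-replicate q) ⟩
      Sum.sum enum + q · 1#                 ∎

  private
    nonzeroPart : Carrier → Carrier
    nonzeroPart x with ≈0? x
    ... | yes _ = 1#
    ... | no  _ = x

    nonzeroPart-cong : ∀ {x y} → x ≈ y → nonzeroPart x ≈ nonzeroPart y
    nonzeroPart-cong {x} {y} x≈y with ≈0? x | ≈0? y
    ... | yes _   | yes _   = refl
    ... | no  _   | no  _   = x≈y
    ... | yes x≈0 | no  y≉0 = ⊥-elim (y≉0 (trans (sym x≈y) x≈0))
    ... | no  x≉0 | yes y≈0 = ⊥-elim (x≉0 (trans x≈y y≈0))

    nonzeroPart-≉0 : ∀ x → ¬ nonzeroPart x ≈ 0#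
    nonzeroPart-≉0 x with ≈0? x
    ... | yes _   = 1≉0
    ... | no  x≉0 = x≉0

    ∏-≉0 : ∀ {n} (f : Fin n → Carrier) → (∀ i → ¬ f i ≈ 0#) → ¬ Product.sum f ≈ 0#
    ∏-≉0 {zero}  f f≉0 = 1≉0
    ∏-≉0 {suc n} f f≉0 = *-≉0 (f≉0 zero) (∏-≉0 (λ i → f (suc i)) (λ i → f≉0 (suc i)))

  -- Multiplication by c permutes the nonzero elements, so their product P satisfies P = c^(q-1) P.
  module _ (c : Carrier) (c≉0 : ¬ c ≈ 0#) where
    private
      factor : Carrier → Carrier
      factor x with ≈0? x
      ... | yes _ = 1#
      ... | no  _ = c

      nonzeroPart-scale : ∀ x → nonzeroPart (c * x) ≈ factor x * nonzeroPart x
      nonzeroPart-scale x with ≈0? (c * x) | ≈0? x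
      ... | yes _    | yes _   = sym (*-identityˡ 1#)
      ... | no  _    | no  _   = refl
      ... | yes cx≈0 | no  x≉0 = ⊥-elim (x≉0 (xy≈0⇒y≈0 c≉0 cx≈0))
      ... | no  cx≉0 | yes x≈0 = ⊥-elim (cx≉0 (trans (*-congˡ x≈0) (zeroʳ c)))

      P W : Carrier
      P = Product.sum (λ i → nonzeroPart (enum i))
      W = Product.sum (λ i → factor (enum i))

      P≈W*P : P ≈ W * P
      P≈W*P = begin
        P                                                       ≈⟨ Product.sum-permute (λ i → nonzeroPart (enum i)) π ⟩
        Product.sum (λ i → nonzeroPart (enum (π ⟨$⟩ʳ i)))
          ≈⟨ Product.sum-cong-≋ (λ i → trans (nonzeroPart-cong (enum-π i)) (nonzeroPart-scale (enum i))) ⟩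
        Product.sum (λ i → factor (enum i) * nonzeroPart (enum i))
          ≈⟨ Product.∑-distrib-+ (λ i → factor (enum i)) (λ i → nonzeroPart (enum i)) ⟩
        W * P                                                   ∎
        where
        c⁻¹ = c ⁻¹[ c≉0 ]
        c⁻¹c≈1 : c⁻¹ * c ≈ 1#
        c⁻¹c≈1 = trans (*-comm c⁻¹ c) (x*x⁻¹≈1 c c≉0)
        open Relabel (c *_) (c⁻¹ *_) *-congˡ *-congˡ
          (λ x → trans (sym (*-assoc c c⁻¹ x)) (trans (*-congʳ (x*x⁻¹≈1 c c≉0)) (*-identityˡ x)))
          (λ x → trans (sym (*-assoc c⁻¹ c x)) (trans (*-congʳ c⁻¹c≈1) (*-identityˡ x)))

      W≈1 : W ≈ 1#
      W≈1 = x∙y⁻¹≈ε⇒x≈y W 1# (xy≈0⇒y≈0 (∏-≉0 (λ i → nonzeroPart (enum i)) (λ i → nonzeroPart-≉0 (enum i))) P[W-1]≈0)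
        where
        P[W-1]≈0 : P * (W - 1#) ≈ 0#
        P[W-1]≈0 = begin
          P * (W - 1#)        ≈⟨ x[y-z]≈xy-xz P W 1# ⟩
          P * W - P * 1#      ≈⟨ +-cong (*-comm P W) (-‿cong (*-identityʳ P)) ⟩
          W * P - P           ≈⟨ +-congʳ P≈W*P ⟨
          P - P               ≈⟨ -‿inverseʳ P ⟩
          0#                  ∎

      c*∏≈c^n : ∀ {n} (f : Fin n → Carrier) (i₀ : Fin n) → f i₀ ≈ 1# → (∀ j → j ≢ i₀ → f j ≈ c) →
                c * Product.sum f ≈ c ^ n
      c*∏≈c^n {suc n} f i₀ fi₀≈1 f≈c = *-congˡ (begin
        Product.sum f                                           ≈⟨ Product.sum-remove f ⟩
        f i₀ * Product.sum (λ j → f (Fin.punchIn i₀ j))         ≈⟨ *-cong fi₀≈1 (Product.sum-cong-≋ (λ j → f≈c _ (Finₚ.punchInᵢ≢i i₀ j))) ⟩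
        1# * Product.sum {n} (λ _ → c)                          ≈⟨ *-identityˡ _ ⟩
        Product.sum {n} (λ _ → c)                               ≈⟨ Product.sum-replicate n ⟩
        c ^ n                                                   ∎)

      factor-enum-0 : factor (enum (to 0#)) ≈ 1#
      factor-enum-0 with ≈0? (enum (to 0#))
      ... | yes _   = refl
      ... | no  e≉0 = ⊥-elim (e≉0 (enum-to 0#))

      factor-enum-≉0 : ∀ j → j ≢ to 0# → factor (enum j) ≈ c
      factor-enum-≉0 j j≢0 with ≈0? (enum j)
      ... | yes e≈0 = ⊥-elim (j≢0 (≡.trans (≡.sym (to-enum j)) (to-cong e≈0)))
      ... | no  _   = refl

    fermat-≉0 : c ^ q ≈ c
    fermat-≉0 = begin
      c ^ q        ≈⟨ c*∏≈c^n (λ i → factor (enum i)) (to 0#) factor-enum-0 factor-enum-≉0 ⟨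
      c * W        ≈⟨ *-congˡ W≈1 ⟩
      c * 1#       ≈⟨ *-identityʳ c ⟩
      c            ∎

  fermat : ∀ x → x ^ q ≈ x
  fermat x with ≈0? x
  ... | no  x≉0 = fermat-≉0 x x≉0
  ... | yes x≈0 = trans (^-congˡ q x≈0) (trans (0^n≈0 (ℕ.<-trans ℕ.z<s 1<q)) (sym x≈0))

module BinomialPrime where

  open import Data.Nat
  open import Data.Nat.Properties
  open import Data.Nat.Combinatorics using (_C_; nCk+nC[k+1]≡[n+1]C[k+1]; nC1≡n)
  open import Data.Nat.Divisibility using (_∣_; divides; ∣⇒≤)
  open import Data.Nat.Primality using (Prime; euclidsLemma)
  open import Data.Nat.Tactic.RingSolver using (solve-∀)
  open ≡.≡-Reasoning

  [1+k]*[1+n]C[1+k]≡[1+n]*nCk : ∀ n k → suc k * (suc n C suc k) ≡ suc n * (n C k)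
  [1+k]*[1+n]C[1+k]≡[1+n]*nCk zero    zero    = ≡.refl
  [1+k]*[1+n]C[1+k]≡[1+n]*nCk zero    (suc k) = *-zeroʳ (suc (suc k))
  [1+k]*[1+n]C[1+k]≡[1+n]*nCk (suc n) zero    =
    ≡.trans (+-identityʳ _) (≡.trans (nC1≡n (suc (suc n))) (≡.sym (*-identityʳ (suc (suc n)))))
  [1+k]*[1+n]C[1+k]≡[1+n]*nCk (suc n) (suc k) = begin
    suc (suc k) * (suc (suc n) C suc (suc k))  ≡⟨ ≡.cong (suc (suc k) *_) (nCk+nC[k+1]≡[n+1]C[k+1] (suc n) (suc k)) ⟨
    suc (suc k) * (X + Y)                      ≡⟨ l₁ k X Y ⟩
    (suc k * X + X) + suc (suc k) * Y          ≡⟨ ≡.cong₂ (λ u v → (u + X) + v) ([1+k]*[1+n]C[1+k]≡[1+n]*nCk n k)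
                                                                                ([1+k]*[1+n]C[1+k]≡[1+n]*nCk n (suc k)) ⟩
    (suc n * (n C k) + X) + suc n * (n C suc k) ≡⟨ l₂ n (n C k) (n C suc k) X ⟩
    suc n * (n C k + n C suc k) + X            ≡⟨ ≡.cong (λ u → suc n * u + X) (nCk+nC[k+1]≡[n+1]C[k+1] n k) ⟩
    suc n * X + X                              ≡⟨ l₃ n X ⟩
    suc (suc n) * X                            ∎
    where
    X Y : ℕ
    X = suc n C suc k
    Y = suc n C suc (suc k)
    l₁ : ∀ k X Y → suc (suc k) * (X + Y) ≡ (suc k * X + X) + suc (suc k) * Y
    l₁ = solve-∀
    l₂ : ∀ n A B X → (suc n * A + X) + suc n * B ≡ suc n * (A + B) + X
    l₂ = solve-∀
    l₃ : ∀ n X → suc n * X + X ≡ suc (suc n) * X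
    l₃ = solve-∀

  p∣pCk : ∀ {p} → Prime p → ∀ {k} → 0 < k → k < p → p ∣ p C k
  p∣pCk {suc n} p-prime {suc k} _ k<p
    with euclidsLemma (suc k) (suc n C suc k) p-prime
           (divides (n C k) (≡.trans ([1+k]*[1+n]C[1+k]≡[1+n]*nCk n k) (*-comm (suc n) (n C k))))
  ... | inj₂ p∣pCk = p∣pCk
  ... | inj₁ p∣k   = ⊥-elim (<⇒≱ k<p (∣⇒≤ p∣k))

module Frobenius (L : Field) where

  open Field L hiding (zero)
  open import Data.Nat.Combinatorics using (_C_; nCn≡1)
  open import Data.Nat.Divisibility using (divides)
  open import Data.Nat.Primality using (prime⇒nonTrivial)
  open import Relation.Binary.Reasoning.Setoid setoid
  open import Algebra.Definitions.RawMonoid +-rawMonoid using () renaming (_×_ to _·_)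
  open import Algebra.Properties.Semiring.Exp semiring using (_^_; ^-congˡ; ^-assocʳ)
  open import Algebra.Properties.Semiring.Mult semiring using (×-assoc-*; ×-congʳ; ×-cong; ×-assocˡ)
  open import Algebra.Properties.Semiring.Sum semiring
    using (sum; sum-init-last; sum-cong-≋; sum-replicate; sum-replicate-zero)
  open import Algebra.Properties.CommutativeSemiring.Binomial commutativeSemiring
    using (binomialTerm; theorem)

  n·0≈0 : ∀ n → n · 0# ≈ 0#
  n·0≈0 n = trans (sym (sum-replicate n)) (sum-replicate-zero n)

  module _ (x y : Carrier) where

    binomialTerm-first : ∀ n → binomialTerm x y n zero ≈ y ^ n
    binomialTerm-first n = trans (+-identityʳ _) (*-identityˡ _)

    binomialTerm-last : ∀ n → binomialTerm x y n (Fin.fromℕ n) ≈ x ^ n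
    binomialTerm-last n rewrite Finₚ.toℕ-fromℕ n | nCn≡1 n | ℕ.n∸n≡0 n =
      trans (+-identityʳ _) (*-identityʳ _)

    ^-additive : ∀ n → 1 < n → (∀ {k} z → 0 < k → k < n → (n C k) · z ≈ 0#) →
                 (x + y) ^ n ≈ x ^ n + y ^ n
    ^-additive (suc zero) (ℕ.s<s ()) _
    ^-additive n@(suc (suc r)) _ inner≈0 = begin
      (x + y) ^ n                                                   ≈⟨ theorem n x y ⟩
      T zero + sum (λ i → T (suc i))                                ≈⟨ +-congˡ (sum-init-last (λ i → T (suc i))) ⟩
      T zero + (sum (λ j → T (suc (Fin.inject₁ j))) + T (Fin.fromℕ n)) ≈⟨ +-cong (binomialTerm-first n)
                                                                           (+-cong (sum-cong-≋ inner) (binomialTerm-last n)) ⟩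
      y ^ n + (sum {suc r} (λ _ → 0#) + x ^ n)                      ≈⟨ +-congˡ (+-congʳ (sum-replicate-zero (suc r))) ⟩
      y ^ n + (0# + x ^ n)                                          ≈⟨ +-congˡ (+-identityˡ _) ⟩
      y ^ n + x ^ n                                                 ≈⟨ +-comm _ _ ⟩
      x ^ n + y ^ n                                                 ∎
      where
      T : Fin (suc n) → Carrier
      T = binomialTerm x y n
      inner : ∀ j → T (suc (Fin.inject₁ j)) ≈ 0#
      inner j = inner≈0 _ ℕ.z<s (ℕ.s<s (≡.subst (_< suc r) (≡.sym (Finₚ.toℕ-inject₁ j)) (Finₚ.toℕ<n j)))

  module _ {p : ℕ} (p-prime : Prime p) (p·1≈0 : p · 1# ≈ 0#) where

    p·x≈0 : ∀ x → p · x ≈ 0#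
    p·x≈0 x = begin
      p · x           ≈⟨ ×-congʳ p (*-identityˡ x) ⟨
      p · (1# * x)    ≈⟨ ×-assoc-* p 1# x ⟨
      (p · 1#) * x    ≈⟨ *-congʳ p·1≈0 ⟩
      0# * x          ≈⟨ zeroˡ x ⟩
      0#              ∎

    pCk·x≈0 : ∀ {k} x → 0 < k → k < p → (p C k) · x ≈ 0#
    pCk·x≈0 {k} x 0<k k<p with BinomialPrime.p∣pCk p-prime 0<k k<p
    ... | divides s pCk≡s*p = begin
      (p C k) · x       ≈⟨ ×-cong pCk≡s*p refl ⟩
      (s ℕ.* p) · x     ≈⟨ ×-assocˡ x s p ⟨
      s · (p · x)       ≈⟨ ×-congʳ s (p·x≈0 x) ⟩
      s · 0#            ≈⟨ n·0≈0 s ⟩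
      0#                ∎

    frobenius-+ : ∀ x y → (x + y) ^ p ≈ x ^ p + y ^ p
    frobenius-+ x y = ^-additive x y p (ℕ.nonTrivial⇒n>1 p {{prime⇒nonTrivial p-prime}}) pCk·x≈0

    frobenius-+-^ : ∀ e x y → (x + y) ^ (p ^ℕ e) ≈ x ^ (p ^ℕ e) + y ^ (p ^ℕ e)
    frobenius-+-^ zero    x y = trans (*-identityʳ _) (+-cong (sym (*-identityʳ x)) (sym (*-identityʳ y)))
    frobenius-+-^ (suc e) x y = begin
      (x + y) ^ (p *ℕ p ^ℕ e)                 ≈⟨ ^-assocʳ (x + y) p (p ^ℕ e) ⟨
      ((x + y) ^ p) ^ (p ^ℕ e)                ≈⟨ ^-congˡ (p ^ℕ e) (frobenius-+ x y) ⟩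
      (x ^ p + y ^ p) ^ (p ^ℕ e)              ≈⟨ frobenius-+-^ e (x ^ p) (y ^ p) ⟩
      (x ^ p) ^ (p ^ℕ e) + (y ^ p) ^ (p ^ℕ e) ≈⟨ +-cong (^-assocʳ x p (p ^ℕ e)) (^-assocʳ y p (p ^ℕ e)) ⟩
      x ^ (p *ℕ p ^ℕ e) + y ^ (p *ℕ p ^ℕ e)   ∎

module PolynomialRoots (K : Field) where

  import Data.Integer as ℤ
  open Field K hiding (zero)
  open LinAlg K using (sumFin)
  open FieldProperties K
  open IntegerRingSolver commutativeRing
  open import Relation.Binary.Reasoning.Setoid setoid
  open import Algebra.Properties.Semiring.Exp semiring using (_^_)

  evalPoly : ∀ {N} → (Fin N → Carrier) → Carrier → Carrier
  evalPoly {zero}  c z = 0#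
  evalPoly {suc N} c z = c zero + z * evalPoly (λ j → c (suc j)) z

  evalPoly≈sumFin : ∀ {N} (c : Fin N → Carrier) z → evalPoly c z ≈ sumFin (λ j → c j * z ^ Fin.toℕ j)
  evalPoly≈sumFin {zero}  c z = refl
  evalPoly≈sumFin {suc N} c z = +-cong (sym (*-identityʳ (c zero))) (begin
    z * evalPoly (λ j → c (suc j)) z                   ≈⟨ *-congˡ (evalPoly≈sumFin (λ j → c (suc j)) z) ⟩
    z * sumFin (λ j → c (suc j) * z ^ Fin.toℕ j)       ≈⟨ *-distribˡ-sumFin z (λ j → c (suc j) * z ^ Fin.toℕ j) ⟩
    sumFin (λ j → z * (c (suc j) * z ^ Fin.toℕ j))     ≈⟨ sumFin-cong (λ j → x∙yz≈y∙xz z (c (suc j)) _) ⟩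
    sumFin (λ j → c (suc j) * (z * z ^ Fin.toℕ j))     ∎)

  quotient : ∀ {N} → Carrier → (Fin (suc N) → Carrier) → Fin N → Carrier
  quotient {suc N} a c zero    = evalPoly (λ j → c (suc j)) a
  quotient {suc N} a c (suc j) = quotient a (λ j → c (suc j)) j

  division : ∀ {N} a (c : Fin (suc N) → Carrier) z →
             evalPoly c z ≈ (z - a) * evalPoly (quotient a c) z + evalPoly c a
  division {zero} a c z =
    solve 3 (λ c₀ z a → c₀ :+ z :* con (ℤ.+ 0) := (z :- a) :* con (ℤ.+ 0) :+ (c₀ :+ a :* con (ℤ.+ 0))) refl (c zero) z a
  division {suc N} a c z = begin
    c zero + z * evalPoly c′ z                 ≈⟨ +-congˡ (*-congˡ (division a c′ z)) ⟩
    c zero + z * ((z - a) * Q + E)             ≈⟨ regroup (c zero) z a Q E ⟩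
    (z - a) * (E + z * Q) + (c zero + a * E)   ∎
    where
    c′ : Fin (suc N) → Carrier
    c′ j = c (suc j)
    Q E : Carrier
    Q = evalPoly (quotient a c′) z
    E = evalPoly c′ a
    regroup : ∀ c₀ z a Q E → c₀ + z * ((z - a) * Q + E) ≈ (z - a) * (E + z * Q) + (c₀ + a * E)
    regroup = solve 5 (λ c₀ z a Q E → c₀ :+ z :* ((z :- a) :* Q :+ E) := (z :- a) :* (E :+ z :* Q) :+ (c₀ :+ a :* E)) refl

  quotient≈0⇒≈0 : ∀ {N} a (c : Fin (suc N) → Carrier) → (∀ j → quotient a c j ≈ 0#) →
                  evalPoly c a ≈ 0# → ∀ j → c j ≈ 0#
  quotient≈0⇒≈0 {zero}  a c _    ca≈0 zero    = trans (sym (+-identityʳ _)) (trans (+-congˡ (sym (zeroʳ a))) ca≈0)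
  quotient≈0⇒≈0 {suc N} a c q≈0 ca≈0 zero    = begin
    c zero                                   ≈⟨ +-identityʳ _ ⟨
    c zero + 0#                              ≈⟨ +-congˡ (trans (*-congˡ (q≈0 zero)) (zeroʳ a)) ⟨
    c zero + a * evalPoly (λ j → c (suc j)) a ≈⟨ ca≈0 ⟩
    0#                                       ∎
  quotient≈0⇒≈0 {suc N} a c q≈0 ca≈0 (suc j) = quotient≈0⇒≈0 a (λ j → c (suc j)) (λ j → q≈0 (suc j)) (q≈0 zero) j

  roots⇒zero : ∀ N (c : Fin N → Carrier) (ζ : Fin N → Carrier) → (∀ {i j} → ζ i ≈ ζ j → i ≡ j) →
               (∀ l → evalPoly c (ζ l) ≈ 0#) → ∀ j → c j ≈ 0#
  roots⇒zero zero    c ζ ζ-inj roots ()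
  roots⇒zero (suc N) c ζ ζ-inj roots = quotient≈0⇒≈0 (ζ zero) c quotient-vanishes (roots zero)
    where
    a : Carrier
    a = ζ zero
    quotient-vanishes : ∀ j → quotient a c j ≈ 0#
    quotient-vanishes = roots⇒zero N (quotient a c) (λ l → ζ (suc l)) (λ eq → Finₚ.suc-injective (ζ-inj eq)) root
      where
      root : ∀ l → evalPoly (quotient a c) (ζ (suc l)) ≈ 0#
      root l = xy≈0⇒y≈0 (λ ζ-a≈0 → Finₚ.0≢1+n (ζ-inj (sym (x∙y⁻¹≈ε⇒x≈y _ _ ζ-a≈0)))) (begin
        (ζ (suc l) - a) * evalPoly (quotient a c) (ζ (suc l))              ≈⟨ +-identityʳ _ ⟨
        (ζ (suc l) - a) * evalPoly (quotient a c) (ζ (suc l)) + 0#         ≈⟨ +-congˡ (roots zero) ⟨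
        (ζ (suc l) - a) * evalPoly (quotient a c) (ζ (suc l)) + evalPoly c a ≈⟨ division a c (ζ (suc l)) ⟨
        evalPoly c (ζ (suc l))                                             ≈⟨ roots (suc l) ⟩
        0#                                                                 ∎)

module FieldHomomorphism (F L : Field) (ι : Field.Carrier F → Field.Carrier L) (ι-hom : IsFieldHom F L ι) where

  open Field L hiding (zero)
  private module F = Field F
  open IsRingHomomorphism ι-hom public using (⟦⟧-cong; +-homo; *-homo; 0#-homo; 1#-homo; -‿homo)

  ι-≈0 : ∀ {x} → x F.≈ F.0# → ι x ≈ 0#
  ι-≈0 x≈0 = trans (⟦⟧-cong x≈0) 0#-homo

  ι-sub : ∀ x y → ι (x F.- y) ≈ ι x - ι y
  ι-sub x y = trans (+-homo x (F.- y)) (+-congˡ (-‿homo y))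

  ι-sumFin : ∀ {d} (f : Fin d → F.Carrier) → ι (LinAlg.sumFin F f) ≈ LinAlg.sumFin L (λ i → ι (f i))
  ι-sumFin {zero}  f = 0#-homo
  ι-sumFin {suc d} f = trans (+-homo (f zero) (LinAlg.sumFin F (λ i → f (suc i)))) (+-congˡ (ι-sumFin (λ i → f (suc i))))

  IndependentOver : ∀ {w} → (Fin w → Carrier) → Set
  IndependentOver {w} g = ∀ (c : Fin w → F.Carrier) → LinAlg.sumFin L (λ l → ι (c l) * g l) ≈ 0# → ∀ l → c l F.≈ F.0#

module _ (L : Field) where

  open Field L
  open Algebra.Properties.Semiring.Exp semiring using (_^_)

  ^-Additive : ℕ → Set
  ^-Additive q = ∀ x y → (x + y) ^ q ≈ x ^ q + y ^ q

  ^-Fixes : {A : Set} → (A → Carrier) → ℕ → Set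
  ^-Fixes ι q = ∀ c → ι c ^ q ≈ ι c

module MooreIndependence (F L : Field) (ι : Field.Carrier F → Field.Carrier L) (ι-hom : IsFieldHom F L ι)
  {q : ℕ} (1<q : 1 < q) (enum : Fin q → Field.Carrier F)
  (enum-injective : ∀ {i j} → Field._≈_ F (enum i) (enum j) → i ≡ j)
  (^q-additive : ^-Additive L q) (^q-fixes-ι : ^-Fixes L ι q) where

  open Field L hiding (zero)
  private module F = Field F
  open LinAlg L
  open FieldProperties L
  open PolynomialRoots L
  open FieldHomomorphism F L ι ι-hom
  open import Relation.Binary.Reasoning.Setoid setoid
  open import Algebra.Properties.Semiring.Exp semiring using (_^_; ^-congˡ; ^-congʳ; ^-assocʳ)
  open import Algebra.Properties.CommutativeSemiring.Exp commutativeSemiring using (^-distrib-*)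
  open import Algebra.Properties.Ring ring using ([y-z]x≈yx-zx)
  open import Data.Fin using (toℕ)
  private module FP = FieldProperties F

  frob : ℕ → Carrier → Carrier
  frob zero    z = z
  frob (suc i) z = frob i (z ^ q)

  frob-cong : ∀ i {x y} → x ≈ y → frob i x ≈ frob i y
  frob-cong zero    x≈y = x≈y
  frob-cong (suc i) x≈y = frob-cong i (^-congˡ q x≈y)

  frob≈^ : ∀ i z → frob i z ≈ z ^ (q ^ℕ i)
  frob≈^ zero    z = sym (*-identityʳ z)
  frob≈^ (suc i) z = trans (frob≈^ i (z ^ q)) (^-assocʳ z q (q ^ℕ i))

  frob-+ : ∀ i x y → frob i (x + y) ≈ frob i x + frob i y
  frob-+ zero    x y = refl
  frob-+ (suc i) x y = trans (frob-cong i (^q-additive x y)) (frob-+ i (x ^ q) (y ^ q))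

  frob-ι* : ∀ i c z → frob i (ι c * z) ≈ ι c * frob i z
  frob-ι* zero    c z = refl
  frob-ι* (suc i) c z =
    trans (frob-cong i (trans (^-distrib-* (ι c) z q) (*-congʳ (^q-fixes-ι c)))) (frob-ι* i c (z ^ q))

  frob-0 : ∀ i → frob i 0# ≈ 0#
  frob-0 zero    = refl
  frob-0 (suc i) = trans (frob-cong i (0^n≈0 (ℕ.<-trans ℕ.z<s 1<q))) (frob-0 i)

  frob-F-linear : ∀ i {w} (c : Fin w → F.Carrier) (g : Fin w → Carrier) →
                  frob i (sumFin (λ l → ι (c l) * g l)) ≈ sumFin (λ l → ι (c l) * frob i (g l))
  frob-F-linear i {zero}  c g = frob-0 i
  frob-F-linear i {suc w} c g = trans (frob-+ i _ _)
    (+-cong (frob-ι* i (c zero) (g zero)) (frob-F-linear i (λ l → c (suc l)) (λ l → g (suc l))))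

  mooreRow : ∀ {w} → (Fin w → Carrier) → ℕ → Vect (Fin w)
  mooreRow g i l = frob i (g l)

  module _ {w} (g : Fin w → Carrier) (g-ind : IndependentOver g) where

    spanPoint : Fin (q ^ℕ w) → Carrier
    spanPoint idx = sumFin (λ l → ι (enum (Fin.finToFun idx l)) * g l)

    spanPoint-injective : ∀ {a b} → spanPoint a ≈ spanPoint b → a ≡ b
    spanPoint-injective {a} {b} eq =
      ≡.trans (≡.sym (Finₚ.funToFin-finToFin {w} {q} a)) (≡.trans (funToFin-cong coords≡) (Finₚ.funToFin-finToFin {w} {q} b))
      where
      coords : Fin (q ^ℕ w) → Fin w → Fin q
      coords = Fin.finToFun
      c : Fin w → F.Carrier
      c l = enum (coords a l) F.- enum (coords b l)
      c·g≈0 : sumFin (λ l → ι (c l) * g l) ≈ 0#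
      c·g≈0 = begin
        sumFin (λ l → ι (c l) * g l)
          ≈⟨ sumFin-cong (λ l → trans (*-congʳ (ι-sub _ _)) ([y-z]x≈yx-zx (g l) _ _)) ⟩
        sumFin (λ l → ι (enum (coords a l)) * g l - ι (enum (coords b l)) * g l)
          ≈⟨ sumFin-sub (λ l → ι (enum (coords a l)) * g l) (λ l → ι (enum (coords b l)) * g l) ⟩
        spanPoint a - spanPoint b  ≈⟨ +-congʳ eq ⟩
        spanPoint b - spanPoint b  ≈⟨ -‿inverseʳ _ ⟩
        0#                         ∎
      coords≡ : ∀ l → coords a l ≡ coords b l
      coords≡ l = enum-injective (FP.x∙y⁻¹≈ε⇒x≈y _ _ (g-ind c c·g≈0 l))

    moore-vanishes-on-span : ∀ {s} (y : Fin s → Carrier) → lincomb y (λ i → mooreRow g (toℕ i)) ≈v 0v →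
                             ∀ idx → sumFin (λ i → y i * frob (toℕ i) (spanPoint idx)) ≈ 0#
    moore-vanishes-on-span {s} y y·rows≈0 idx = begin
      sumFin (λ i → y i * frob (toℕ i) (spanPoint idx))
        ≈⟨ sumFin-cong {s} (λ i → *-congˡ (frob-F-linear (toℕ i) (λ l → enum (Fin.finToFun idx l)) g)) ⟩
      sumFin (λ i → y i * sumFin (λ l → c l * frob (toℕ i) (g l)))
        ≈⟨ sumFin-exchange y c (λ i l → frob (toℕ i) (g l)) ⟩
      sumFin (λ l → c l * sumFin (λ i → y i * frob (toℕ i) (g l)))
        ≈⟨ sumFin-zero (λ l → trans (*-congˡ (y·rows≈0 l)) (zeroʳ (c l))) ⟩
      0# ∎
      where
      c : Fin w → Carrier
      c l = ι (enum (Fin.finToFun idx l))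

    module _ {s} (s≤w : s ≤ w) (y : Fin s → Carrier) where

      q^i<q^w : ∀ (i : Fin s) → q ^ℕ toℕ i < q ^ℕ w
      q^i<q^w i = ℕ.^-monoʳ-< q 1<q (ℕ.<-≤-trans (Finₚ.toℕ<n i) s≤w)

      qPower : Fin s → Fin (q ^ℕ w)
      qPower i = Fin.fromℕ< (q^i<q^w i)

      qPower-injective : ∀ {i j} → qPower i ≡ qPower j → i ≡ j
      qPower-injective {i} {j} eq = Finₚ.toℕ-injective (^-injectiveʳ 1<q
        (≡.trans (≡.sym (Finₚ.toℕ-fromℕ< (q^i<q^w i))) (≡.trans (≡.cong toℕ eq) (Finₚ.toℕ-fromℕ< (q^i<q^w j)))))

      -- The coefficients of the q-polynomial Σ_i y_i z^(q^i), of degree < q^w.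
      linearized : Fin (q ^ℕ w) → Carrier
      linearized j = sumFin (λ i → y i * δ j (qPower i))

      linearized-qPower : ∀ i → linearized (qPower i) ≈ y i
      linearized-qPower i = trans (sumFin-cong (λ j → *-congˡ (trans (δ-injective qPower-injective i j)
                                                                     (reflexive (δ-comm i j)))))
                                  (sumFin-δʳ i y)

      evalPoly-linearized : ∀ z → evalPoly linearized z ≈ sumFin (λ i → y i * frob (toℕ i) z)
      evalPoly-linearized z = begin
        evalPoly linearized z
          ≈⟨ evalPoly≈sumFin linearized z ⟩
        sumFin (λ j → linearized j * z ^ toℕ j)
          ≈⟨ sumFin-cong (λ j → *-comm (linearized j) (z ^ toℕ j)) ⟩
        sumFin (λ j → z ^ toℕ j * linearized j)
          ≈⟨ sumFin-exchange (λ j → z ^ toℕ j) y (λ j i → δ j (qPower i)) ⟩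
        sumFin (λ i → y i * sumFin (λ j → z ^ toℕ j * δ j (qPower i)))
          ≈⟨ sumFin-cong (λ i → *-congˡ (sumFin-δʳ (qPower i) (λ j → z ^ toℕ j))) ⟩
        sumFin (λ i → y i * z ^ toℕ (qPower i))
          ≈⟨ sumFin-cong (λ i → *-congˡ (trans (^-congʳ z (Finₚ.toℕ-fromℕ< (q^i<q^w i))) (sym (frob≈^ (toℕ i) z)))) ⟩
        sumFin (λ i → y i * frob (toℕ i) z)
          ∎

  moore-independent : ∀ {w} (g : Fin w → Carrier) → IndependentOver g →
                      ∀ {s} → s ≤ w → LinIndep (λ (i : Fin s) → mooreRow g (toℕ i))
  moore-independent {w} g g-ind s≤w y y·rows≈0 i = begin
    y i                              ≈⟨ linearized-qPower g g-ind s≤w y i ⟨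
    linearized g g-ind s≤w y (qPower g g-ind s≤w y i)
      ≈⟨ roots⇒zero (q ^ℕ w) _ (spanPoint g g-ind) (spanPoint-injective g g-ind) root (qPower g g-ind s≤w y i) ⟩
    0#                               ∎
    where
    root : ∀ idx → evalPoly (linearized g g-ind s≤w y) (spanPoint g g-ind idx) ≈ 0#
    root idx = trans (evalPoly-linearized g g-ind s≤w y _) (moore-vanishes-on-span g g-ind y y·rows≈0 idx)

-- For m + k ≤ n take t = 0; otherwise r = n - k and t = m + k - n, and then
-- m k - n t = (n - k)(n - m) > 0.
column-split : ∀ {n k m} → m < n → 0 < k → k < n → 1 < m →
               ∃[ t ] ∃[ r ] t +ℕ r ≡ m × r +ℕ k ≤ n × n *ℕ t < m *ℕ k
column-split {n} {k} {m} m<n 0<k k<n 1<m with m +ℕ k ℕ.≤? n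
... | yes m+k≤n = 0 , m , ≡.refl , m+k≤n , ≡.subst (_< m *ℕ k) (≡.sym (ℕ.*-zeroʳ n)) (ℕ.*-mono-≤ (ℕ.<⇒≤ 1<m) 0<k)
... | no  m+k≰n with ℕ.m≤n⇒∃[o]m+o≡n (ℕ.≰⇒≥ m+k≰n) | ℕ.m≤n⇒∃[o]m+o≡n k<n
...   | t , n+t≡m+k | a , [1+k]+a≡n = t , r , t+r≡m , ℕ.≤-reflexive r+k≡n , nt<mk
  where
  open import Data.Nat.Tactic.RingSolver using (solve-∀)
  r : ℕ
  r = suc a
  r+k≡n : r +ℕ k ≡ n
  r+k≡n = ≡.trans (≡.cong suc (ℕ.+-comm a k)) [1+k]+a≡n
  t+r≡m : t +ℕ r ≡ m
  t+r≡m = ℕ.+-cancelʳ-≡ k (t +ℕ r) m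
    (≡.trans (ℕ.+-assoc t r k) (≡.trans (≡.cong (t +ℕ_) r+k≡n) (≡.trans (ℕ.+-comm t n) n+t≡m+k)))
  t<k : t < k
  t<k = ℕ.+-cancelʳ-< r t k (≡.subst₂ _<_ (≡.sym t+r≡m) (≡.trans (≡.sym r+k≡n) (ℕ.+-comm r k)) m<n)
  nt<mk : n *ℕ t < m *ℕ k
  nt<mk = ≡.subst₂ _<_ (≡.trans (expand₁ r k t) (≡.cong (_*ℕ t) r+k≡n)) (≡.trans (expand₂ r k t) (≡.cong (_*ℕ k) t+r≡m))
            (ℕ.+-monoʳ-< (k *ℕ t) (ℕ.*-monoʳ-< r t<k))
    where
    expand₁ : ∀ r k t → k *ℕ t +ℕ r *ℕ t ≡ (r +ℕ k) *ℕ t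
    expand₁ = solve-∀
    expand₂ : ∀ r k t → k *ℕ t +ℕ r *ℕ k ≡ (t +ℕ r) *ℕ k
    expand₂ = solve-∀

module MatrixCodes (F : Field) (≈0? : ∀ x → Dec (Field._≈_ F x (Field.0# F))) (n : ℕ) where

  open Field F hiding (zero)
  open LinAlg F
  open QMatroid F n
  open FieldProperties F
  open LinearSystems F ≈0?
  open import Relation.Binary.Reasoning.Setoid setoid
  open import Data.Unit using (⊤; tt)


  fullSpace : Subspace (Fin n)
  fullSpace = record { mem = λ _ → ⊤ ; resp = λ _ _ → tt ; has0 = tt ; closed+ = λ _ _ → tt ; closed· = λ _ _ → tt }

  fullSpace-HasDim : HasDim (mem fullSpace) n
  fullSpace-HasDim = unit , (λ _ → tt) , unit-independent , (λ x _ → x , (λ i → sym (lincomb-unit x i)))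

  restrict-perp-fullSpace : ∀ {m} (C : Pred (Fin n × Fin m)) → HasDim (restrict C (perp (mem fullSpace))) 0
  restrict-perp-fullSpace C = (λ ()) , (λ ()) , (λ _ _ ()) , only-zero
    where
    only-zero : restrict C (perp (mem fullSpace)) ⊆ Span (λ ())
    only-zero M (_ , colsp⊆perp) = (λ ()) , λ (i , j) →
      trans (sym (dot-unitʳ (col M j) i)) (colsp⊆perp (col M j) (∈-Span (col M) j) (unit i) tt)

  colsp⊆perp-Span : ∀ {m d} (M : Mat n m) (u : Fin d → Vect (Fin n)) →
                    (∀ j l → dot (col M j) (u l) ≈ 0#) → colsp M ⊆ perp (Span u)
  colsp⊆perp-Span M u M⊥u x x∈colsp y y∈U = Span-orthogonal (col M) u M⊥u x x∈colsp y y∈U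

  restrict-perp-Span-HasDim : ∀ {m k′ d} (C : Subspace (Fin n × Fin m)) → HasDim (mem C) k′ →
                              (u : Fin d → Vect (Fin n)) → ∃[ e ] HasDim (restrict (mem C) (perp (Span u))) e
  restrict-perp-Span-HasDim {m} {k′} {d} C (b , b∈C , b-ind , C⊆b) u =
    dim , (λ a → lincomb (basis a) b) , ∈restrict , independent′ , spanning′
    where
    φ : Fin m → Fin d → Vect (Fin k′)
    φ j l a = dot (col (b a) j) (u l)
    open KernelBasis (kernelBasis (pairIndexed φ))
    coeffs-⊥ : ∀ {c} → (∀ j l → dot (col (lincomb c b) j) (u l) ≈ 0#) → Kernel (pairIndexed φ) c
    coeffs-⊥ {c} cb⊥u = Kernel-pairIndexed⁺ φ (λ j l →
      trans (sumFin-cong (λ a → *-comm (φ j l a) (c a))) (trans (sym (dot-lincombˡ c (λ a → col (b a) j) (u l))) (cb⊥u j l)))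
    ⊥-coeffs : ∀ {c} → Kernel (pairIndexed φ) c → ∀ j l → dot (col (lincomb c b) j) (u l) ≈ 0#
    ⊥-coeffs {c} c∈ker j l =
      trans (dot-lincombˡ c (λ a → col (b a) j) (u l))
            (trans (sumFin-cong (λ a → *-comm (c a) (φ j l a))) (Kernel-pairIndexed⁻ φ c∈ker j l))
    ∈restrict : ∀ a → restrict (mem C) (perp (Span u)) (lincomb (basis a) b)
    ∈restrict a = lincomb-closed C (basis a) b b∈C , colsp⊆perp-Span _ u (⊥-coeffs (basis⊆kernel a))
    independent′ : LinIndep (λ a → lincomb (basis a) b)
    independent′ β β·w≈0 = independent β (λ a′ → b-ind (lincomb β basis) (λ p → trans (sym (lincomb-lincomb β basis b p)) (β·w≈0 p)) a′)
    spanning′ : restrict (mem C) (perp (Span u)) ⊆ Span (λ a → lincomb (basis a) b)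
    spanning′ M (M∈C , colsp⊆perp) with C⊆b M M∈C
    ... | c , M≈cb with kernel⊆span c (coeffs-⊥ (λ j l → trans (sym (dot-congˡ (u l) (λ i → M≈cb (i , j))))
                                                  (colsp⊆perp (col M j) (∈-Span (col M) j) (u l) (∈-Span u l))))
    ... | γ , c≈γw = γ , (λ p → trans (M≈cb p) (trans (lincomb-cong {v = b} c≈γw (λ _ _ → refl) p) (sym (lincomb-lincomb γ basis b p))))

  module Obstruction {k t r k′ : ℕ} (k<n : k < n) (r+k≤n : r +ℕ k ≤ n) (nt<[t+r]k : n *ℕ t < (t +ℕ r) *ℕ k)
    (C : Subspace (Fin n × Fin (t +ℕ r))) (C-dim : HasDim (mem C) k′)
    (rep : ∀ (U : Subspace (Fin n)) ρ e → uniformRank k U ρ →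
           HasDim (restrict (mem C) (perp (mem U))) e → (t +ℕ r) *ℕ ρ +ℕ e ≡ k′) where

    b : Fin k′ → Mat n (t +ℕ r)
    b = proj₁ C-dim

    k′≡[t+r]k : k′ ≡ (t +ℕ r) *ℕ k
    k′≡[t+r]k = ≡.sym (≡.trans (≡.sym (ℕ.+-identityʳ _))
      (rep fullSpace k 0 (n , fullSpace-HasDim , ≡.sym (ℕ.m≤n⇒m⊓n≡m (ℕ.<⇒≤ k<n))) (restrict-perp-fullSpace _)))

    leftColumns : Fin n → Fin t → Vect (Fin k′)
    leftColumns i j a = b a (i , j ↑ˡ r)

    nontrivial : ∃[ c ] Kernel (pairIndexed leftColumns) c × ¬ c ≈v 0v
    nontrivial = kernel-nontrivial (pairIndexed leftColumns) (≡.subst (n *ℕ t <_) (≡.sym k′≡[t+r]k) nt<[t+r]k)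

    c₀ : Vect (Fin k′)
    c₀ = proj₁ nontrivial

    M₀ : Mat n (t +ℕ r)
    M₀ = lincomb c₀ b

    M₀-left≈0 : ∀ j → col M₀ (j ↑ˡ r) ≈v 0v
    M₀-left≈0 j i = trans (sumFin-cong (λ a → *-comm (c₀ a) (leftColumns i j a)))
                          (Kernel-pairIndexed⁻ leftColumns (proj₁ (proj₂ nontrivial)) i j)

    rightColumns : Fin r → Vect (Fin n)
    rightColumns j = col M₀ (t ↑ʳ j)

    open KernelBasis (kernelBasis rightColumns) renaming (dim to d; basis to u)

    k≤d : k ≤ d
    k≤d = ℕ.+-cancelˡ-≤ r k d (ℕ.≤-trans r+k≤n (≡.subst (n ≤_) (ℕ.+-comm d r) rank-nullity))

    ρU≡k : uniformRank k (spanSubspace u) k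
    ρU≡k = d , span-HasDim u independent , ≡.sym (ℕ.m≤n⇒m⊓n≡m k≤d)

    M₀∈C[U⊥] : restrict (mem C) (perp (Span u)) M₀
    M₀∈C[U⊥] = lincomb-closed C c₀ b (proj₁ (proj₂ C-dim)) , colsp⊆perp-Span M₀ u M₀⊥u
      where
      M₀⊥u : ∀ j l → dot (col M₀ j) (u l) ≈ 0#
      M₀⊥u j l with ↑ˡ-or-↑ʳ {t} {r} j
      ... | inj₁ (j′ , ≡.refl) = dot-zeroˡ (u l) (M₀-left≈0 j′)
      ... | inj₂ (j′ , ≡.refl) = basis⊆kernel l j′

    M₀≈0 : M₀ ≈v 0v
    M₀≈0 with restrict-perp-Span-HasDim C C-dim u
    ... | e , C[U⊥]-dim = HasDim-0⇒trivial C[U⊥]-dim e≡0 M₀ M₀∈C[U⊥]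
      where
      e≡0 : e ≡ 0
      e≡0 = ℕ.+-cancelˡ-≡ ((t +ℕ r) *ℕ k) e 0
              (≡.trans (rep (spanSubspace u) k e ρU≡k C[U⊥]-dim) (≡.trans k′≡[t+r]k (≡.sym (ℕ.+-identityʳ _))))

    absurd : ⊥
    absurd = proj₂ (proj₂ nontrivial) (proj₁ (proj₂ (proj₂ C-dim)) c₀ M₀≈0)

  uniform-not-MatRepresentable : ∀ {k t r} → k < n → r +ℕ k ≤ n → n *ℕ t < (t +ℕ r) *ℕ k →
                                 ¬ MatRepresentable (t +ℕ r) (uniformRank k)
  uniform-not-MatRepresentable k<n r+k≤n nt<[t+r]k (C , k′ , C-dim , rep) =
    Obstruction.absurd k<n r+k≤n nt<[t+r]k C C-dim rep

module GabidulinCode (F L : Field) (ι : Field.Carrier F → Field.Carrier L) (ι-hom : IsFieldHom F L ι)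
  (≈0?ᴸ : ∀ x → Dec (Field._≈_ L x (Field.0# L)))
  {q : ℕ} (1<q : 1 < q) (enum : Fin q → Field.Carrier F)
  (enum-injective : ∀ {i j} → Field._≈_ F (enum i) (enum j) → i ≡ j)
  (^q-additive : ^-Additive L q) (^q-fixes-ι : ^-Fixes L ι q)
  {n k m′ : ℕ} (k≤n : k ≤ n) (γ : Fin (n +ℕ m′) → Field.Carrier L) (γ-basis : IsBasisOver F L ι γ) where

  open Field L hiding (zero)
  private
    module F = Field F
    module Fᴸ = LinAlg F
    module FP = FieldProperties F
  open LinAlg L
  open FieldProperties L
  open LinearSystems L ≈0?ᴸ
  open FieldHomomorphism F L ι ι-hom
  open MooreIndependence F L ι ι-hom 1<q enum enum-injective ^q-additive ^q-fixes-ι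
  open QMatroid F n
  open Ext L ι γ
  open import Relation.Binary.Reasoning.Setoid setoid
  open import Data.Fin using (toℕ)

  γ-independent : ∀ (c : Fin (n +ℕ m′) → F.Carrier) → sumFin (λ t → ι (c t) * γ t) ≈ 0# → ∀ t → c t F.≈ F.0#
  γ-independent = proj₁ γ-basis

  γ-coordinates : ∀ x → Σ (Fin (n +ℕ m′) → F.Carrier) λ c → x ≈ sumFin (λ t → ι (c t) * γ t)
  γ-coordinates = proj₂ γ-basis

  g : Fin n → Carrier
  g j = γ (j ↑ˡ m′)

  g-independent : IndependentOver g
  g-independent c c·g≈0 j = F.trans (F.reflexive (≡.sym (VecF.lookup-++ˡ c zeros j))) (γ-independent (c Vec.++ zeros) c′·γ≈0 (j ↑ˡ m′))
    where
    zeros : Fin m′ → F.Carrier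
    zeros _ = F.0#
    c′·γ≈0 : sumFin (λ t → ι ((c Vec.++ zeros) t) * γ t) ≈ 0#
    c′·γ≈0 = begin
      sumFin (λ t → ι ((c Vec.++ zeros) t) * γ t)
        ≈⟨ sumFin-↑ {n} {m′} (λ t → ι ((c Vec.++ zeros) t) * γ t) ⟩
      sumFin (λ i → ι ((c Vec.++ zeros) (i ↑ˡ m′)) * g i) + sumFin (λ j → ι ((c Vec.++ zeros) (n ↑ʳ j)) * γ (n ↑ʳ j))
        ≈⟨ +-cong (sumFin-cong (λ i → *-congʳ (reflexive (≡.cong ι (VecF.lookup-++ˡ c zeros i)))))
                  (sumFin-zero (λ j → trans (*-congʳ (trans (reflexive (≡.cong ι (VecF.lookup-++ʳ c zeros j))) 0#-homo))
                                           (zeroˡ _))) ⟩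
      sumFin (λ i → ι (c i) * g i) + 0#      ≈⟨ +-identityʳ _ ⟩
      sumFin (λ i → ι (c i) * g i)           ≈⟨ c·g≈0 ⟩
      0#                                     ∎

  G : Fin k → Vect (Fin n)
  G i = mooreRow g (toℕ i)

  G-independent : LinIndep G
  G-independent = moore-independent g g-independent k≤n

  pairing-expansion : ∀ {x A} → IsExpansion x A → ∀ (v : Fᴸ.Vect (Fin n)) →
                      sumFin (λ j → x j * ι (v j)) ≈ sumFin (λ t → ι (Fᴸ.dot (Fᴸ.col A t) v) * γ t)
  pairing-expansion {x} {A} x≈Aγ v = begin
    sumFin (λ j → x j * ι (v j))
      ≈⟨ sumFin-cong (λ j → trans (*-congʳ (x≈Aγ j)) (*-comm _ (ι (v j)))) ⟩
    sumFin (λ j → ι (v j) * sumFin (λ t → ι (A (j , t)) * γ t))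
      ≈⟨ sumFin-cong (λ j → *-congˡ (sumFin-cong (λ t → *-comm (ι (A (j , t))) (γ t)))) ⟩
    sumFin (λ j → ι (v j) * sumFin (λ t → γ t * ι (A (j , t))))
      ≈⟨ sumFin-exchange (λ j → ι (v j)) γ (λ j t → ι (A (j , t))) ⟩
    sumFin (λ t → γ t * sumFin (λ j → ι (v j) * ι (A (j , t))))
      ≈⟨ sumFin-cong (λ t → trans (*-comm (γ t) _) (*-congʳ (sym ι-dot))) ⟩
    sumFin (λ t → ι (Fᴸ.dot (Fᴸ.col A t) v) * γ t)
      ∎
    where
    ι-dot : ∀ {t} → ι (Fᴸ.dot (Fᴸ.col A t) v) ≈ sumFin (λ j → ι (v j) * ι (A (j , t)))
    ι-dot {t} = trans (ι-sumFin (λ j → A (j , t) F.* v j)) (sumFin-cong (λ j → trans (*-homo (A (j , t)) (v j)) (*-comm _ _)))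

  module _ (W : Fᴸ.Subspace (Fin n)) {d : ℕ} (B : Fin d → Fᴸ.Vect (Fin n))
           (B∈W : ∀ l → Fᴸ.mem W (B l)) (W⊆B : Fᴸ.mem W Fᴸ.⊆ Fᴸ.Span B) (B-ind : Fᴸ.LinIndep B) where

    pairing : Vect (Fin n) → Fin d → Carrier
    pairing x l = sumFin (λ j → x j * ι (B l j))

    SuppIn⇒pairing≈0 : ∀ {x} → SuppIn x (Fᴸ.perp (Fᴸ.mem W)) → ∀ l → pairing x l ≈ 0#
    SuppIn⇒pairing≈0 (A , x≈Aγ , colsp⊆W⊥) l = trans (pairing-expansion x≈Aγ (B l))
      (sumFin-zero (λ t → trans (*-congʳ (ι-≈0 (colsp⊆W⊥ (Fᴸ.col A t) (FP.∈-Span (Fᴸ.col A) t) (B l) (B∈W l)))) (zeroˡ (γ t))))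

    pairing≈0⇒SuppIn : ∀ {x} → (∀ l → pairing x l ≈ 0#) → SuppIn x (Fᴸ.perp (Fᴸ.mem W))
    pairing≈0⇒SuppIn {x} x⊥B = A , x≈Aγ , λ z z∈colsp w w∈W → FP.Span-orthogonal (Fᴸ.col A) B A⊥B z z∈colsp w (W⊆B w w∈W)
      where
      A : Fᴸ.Mat n (n +ℕ m′)
      A (j , t) = proj₁ (γ-coordinates (x j)) t
      x≈Aγ : IsExpansion x A
      x≈Aγ j = proj₂ (γ-coordinates (x j))
      A⊥B : ∀ t l → Fᴸ.dot (Fᴸ.col A t) (B l) F.≈ F.0#
      A⊥B t l = γ-independent (λ t → Fᴸ.dot (Fᴸ.col A t) (B l)) (trans (sym (pairing-expansion x≈Aγ (B l))) (x⊥B l)) t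

    g′ : Fin d → Carrier
    g′ l = sumFin (λ j → ι (B l j) * g j)

    g′-independent : IndependentOver g′
    g′-independent c c·g′≈0 = B-ind c (g-independent (Fᴸ.lincomb c B) cB·g≈0)
      where
      cB·g≈0 : sumFin (λ j → ι (Fᴸ.lincomb c B j) * g j) ≈ 0#
      cB·g≈0 = begin
        sumFin (λ j → ι (Fᴸ.lincomb c B j) * g j)
          ≈⟨ sumFin-cong (λ j → trans (*-comm _ (g j)) (*-congˡ (ι-lincomb j))) ⟩
        sumFin (λ j → g j * sumFin (λ l → ι (c l) * ι (B l j)))
          ≈⟨ sumFin-exchange (λ l → ι (c l)) g (λ l j → ι (B l j)) ⟨
        sumFin (λ l → ι (c l) * sumFin (λ j → g j * ι (B l j)))
          ≈⟨ sumFin-cong (λ l → *-congˡ (sumFin-cong (λ j → *-comm (g j) (ι (B l j))))) ⟩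
        sumFin (λ l → ι (c l) * g′ l)           ≈⟨ c·g′≈0 ⟩
        0#                                      ∎
        where
        ι-lincomb : ∀ j → ι (Fᴸ.lincomb c B j) ≈ sumFin (λ l → ι (c l) * ι (B l j))
        ι-lincomb j = trans (ι-sumFin (λ l → c l F.* B l j)) (sumFin-cong (λ l → *-homo (c l) (B l j)))

    pairing-G : ∀ y l → pairing (lincomb y G) l ≈ lincomb y (λ i → mooreRow g′ (toℕ i)) l
    pairing-G y l = begin
      sumFin (λ j → sumFin (λ i → y i * frob (toℕ i) (g j)) * ι (B l j))
        ≈⟨ sumFin-cong (λ j → *-comm _ (ι (B l j))) ⟩
      sumFin (λ j → ι (B l j) * sumFin (λ i → y i * frob (toℕ i) (g j)))
        ≈⟨ sumFin-exchange (λ j → ι (B l j)) y (λ j i → frob (toℕ i) (g j)) ⟩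
      sumFin (λ i → y i * sumFin (λ j → ι (B l j) * frob (toℕ i) (g j)))
        ≈⟨ sumFin-cong {k} (λ i → *-congˡ (sym (frob-F-linear (toℕ i) (B l) g))) ⟩
      sumFin (λ i → y i * frob (toℕ i) (g′ l))   ∎

    Supported : Pred (Fin n)
    Supported x = Span G x × SuppIn x (Fᴸ.perp (Fᴸ.mem W))

    φ : Fin d → Vect (Fin k)
    φ l i = frob (toℕ i) (g′ l)

    Kernel⇒rows≈0 : ∀ {y} → Kernel φ y → lincomb y (λ i → mooreRow g′ (toℕ i)) ≈v 0v
    Kernel⇒rows≈0 {y} y∈ker l = trans (sumFin-cong (λ i → *-comm (y i) (φ l i))) (y∈ker l)

    dot-φ : ∀ y l → dot (φ l) y ≈ pairing (lincomb y G) l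
    dot-φ y l = trans (sumFin-cong (λ i → *-comm (φ l i) (y i))) (sym (pairing-G y l))

    Supported⇒Kernel : ∀ {x y} → x ≈v lincomb y G → SuppIn x (Fᴸ.perp (Fᴸ.mem W)) → Kernel φ y
    Supported⇒Kernel {y = y} x≈yG supp l =
      trans (dot-φ y l) (trans (sumFin-cong (λ j → *-congʳ (sym (x≈yG j)))) (SuppIn⇒pairing≈0 supp l))

    Kernel⇒Supported : ∀ {y} → Kernel φ y → Supported (lincomb y G)
    Kernel⇒Supported {y} y∈ker = (y , λ _ → refl) , pairing≈0⇒SuppIn (λ l → trans (sym (dot-φ y l)) (y∈ker l))

    Supported-trivial : k ≤ d → ∀ x → Supported x → x ≈v 0v
    Supported-trivial k≤d x ((y , x≈yG) , supp) p = trans (x≈yG p) (lincomb-zero G y≈0 p)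
      where
      y≈0 : ∀ i → y i ≈ 0#
      y≈0 = moore-independent g′ g′-independent k≤d y (Kernel⇒rows≈0 (Supported⇒Kernel x≈yG supp))

    module _ {e} (S-dim : HasDim Supported e) where

      E : Fin e → Vect (Fin n)
      E = proj₁ S-dim

      yE : Fin e → Vect (Fin k)
      yE a = proj₁ (proj₁ (proj₁ (proj₂ S-dim) a))

      E≈yE·G : ∀ a → E a ≈v lincomb (yE a) G
      E≈yE·G a = proj₂ (proj₁ (proj₁ (proj₂ S-dim) a))

      yE∈kernel : ∀ a → Kernel φ (yE a)
      yE∈kernel a = Supported⇒Kernel (E≈yE·G a) (proj₂ (proj₁ (proj₂ S-dim) a))

      yE-independent : LinIndep yE
      yE-independent c c·yE≈0 = proj₁ (proj₂ (proj₂ S-dim)) c (λ p → begin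
        lincomb c E p                               ≈⟨ lincomb-cong (λ _ → refl) E≈yE·G p ⟩
        lincomb c (λ a → lincomb (yE a) G) p        ≈⟨ lincomb-lincomb c yE G p ⟩
        lincomb (lincomb c yE) G p                  ≈⟨ lincomb-zero G c·yE≈0 p ⟩
        0#                                          ∎)

      -- On the first d coordinates the functionals φ form an invertible Moore matrix, so the
      -- first d unit vectors extend the coefficient vectors of a basis of S to an independent family.
      e+d≤k : d ≤ k → e +ℕ d ≤ k
      e+d≤k d≤k = independent-≤ (yE Vec.++ units) unit (++-independent yE units yE-independent units-part)
                                (λ a → _ , (λ i → sym (lincomb-unit _ i)))
        where
        inj : Fin d → Fin k
        inj i = Fin.inject≤ i d≤k
        units : Fin d → Vect (Fin k)
        units i = unit (inj i)
        units-part : ∀ cv cw → (lincomb cv yE +v lincomb cw units) ≈v 0v → ∀ i → cw i ≈ 0#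
        units-part cv cw Y+Z≈0 = moore-independent g′ g′-independent ℕ.≤-refl cw (λ l → begin
          sumFin (λ i → cw i * frob (toℕ i) (g′ l))                 ≈⟨ sumFin-cong (λ i → *-congˡ (sym (dot-φ-unit i l))) ⟩
          sumFin (λ i → cw i * dot (φ l) (units i))                 ≈⟨ dot-lincombʳ (φ l) cw units ⟨
          dot (φ l) (lincomb cw units)                              ≈⟨ +-identityˡ _ ⟨
          0# + dot (φ l) (lincomb cw units)                         ≈⟨ +-congʳ (dot-φ-Y l) ⟨
          dot (φ l) (lincomb cv yE) + dot (φ l) (lincomb cw units)  ≈⟨ dot-+ʳ (φ l) _ _ ⟨
          dot (φ l) (lincomb cv yE +v lincomb cw units)             ≈⟨ sumFin-zero (λ i → trans (*-congˡ (Y+Z≈0 i)) (zeroʳ _)) ⟩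
          0#                                                        ∎)
          where
          dot-φ-unit : ∀ i l → dot (φ l) (units i) ≈ frob (toℕ i) (g′ l)
          dot-φ-unit i l = trans (dot-unitʳ (φ l) (inj i)) (reflexive (≡.cong (λ t → frob t (g′ l)) (Finₚ.toℕ-inject≤ i d≤k)))
          dot-φ-Y : ∀ l → dot (φ l) (lincomb cv yE) ≈ 0#
          dot-φ-Y l = trans (dot-lincombʳ (φ l) cv yE) (sumFin-zero (λ a → trans (*-congˡ (yE∈kernel a l)) (zeroʳ (cv a))))

      k≤d+e : k ≤ d +ℕ e
      k≤d+e = ℕ.≤-trans rank-nullity (≡.subst (dim +ℕ d ≤_) (ℕ.+-comm e d) (ℕ.+-monoˡ-≤ d dim≤e))
        where
        open KernelBasis (kernelBasis φ)
        dim≤e : dim ≤ e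
        dim≤e = independent-≤ (λ a → lincomb (basis a) G) E
          (λ β β·uG≈0 → independent β (G-independent (lincomb β basis) (λ p → trans (sym (lincomb-lincomb β basis G p)) (β·uG≈0 p))))
          (λ a → proj₂ (proj₂ (proj₂ S-dim)) _ (Kernel⇒Supported (basis⊆kernel a)))

    rank-equation : ∀ {e} → HasDim Supported e → k ⊓ d +ℕ e ≡ k
    rank-equation {e} S-dim with k ℕ.≤? d
    ... | yes k≤d = ≡.trans (≡.cong₂ _+ℕ_ (ℕ.m≤n⇒m⊓n≡m k≤d) (trivial⇒HasDim-0 S-dim (Supported-trivial k≤d))) (ℕ.+-identityʳ k)
    ... | no  k≰d = ≡.trans (≡.cong (_+ℕ e) (ℕ.m≥n⇒m⊓n≡n d≤k))
                            (ℕ.≤-antisym (≡.subst (_≤ k) (ℕ.+-comm e d) (e+d≤k S-dim d≤k)) (k≤d+e S-dim))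
      where
      d≤k : d ≤ k
      d≤k = ℕ.<⇒≤ (ℕ.≰⇒> k≰d)

  extRepresentable : ExtRepresentable (uniformRank k)
  extRepresentable = spanSubspace G , k , span-HasDim G G-independent , rank
    where
    rank : ∀ (W : Fᴸ.Subspace (Fin n)) r e → uniformRank k W r →
           HasDim (λ x → Span G x × SuppIn x (Fᴸ.perp (Fᴸ.mem W))) e → r +ℕ e ≡ k
    rank W r e (d , (B , B∈W , B-ind , W⊆B) , r≡k⊓d) S-dim =
      ≡.trans (≡.cong (_+ℕ e) r≡k⊓d) (rank-equation W B B∈W W⊆B B-ind S-dim)

module FiniteExtension (F L : Field) (ι : Field.Carrier F → Field.Carrier L) (ι-hom : IsFieldHom F L ι)
  {q : ℕ} (card : HasCard F q) {m : ℕ} (γ : Fin m → Field.Carrier L) (γ-basis : IsBasisOver F L ι γ) where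

  open Field L hiding (zero)
  private
    module F = Field F
    module FF = FiniteField F card
  open LinAlg L using (sumFin)
  open FieldProperties L
  open FieldHomomorphism F L ι ι-hom
  open import Relation.Binary.Reasoning.Setoid setoid
  open import Algebra.Properties.Semiring.Exp semiring using (_^_)
  open import Algebra.Definitions.RawMonoid +-rawMonoid using () renaming (_×_ to _·_)
  open import Algebra.Definitions.RawMonoid F.+-rawMonoid using () renaming (_×_ to _·ᶠ_)
  open import Algebra.Properties.Semiring.Mult semiring using (×1-homo-*; ×-congˡ)
  private module Expᶠ = Algebra.Properties.Semiring.Exp F.semiring

  ≈0? : ∀ x → Dec (x ≈ 0#)
  ≈0? x with Finₚ.all? (λ j → FF.≈0? (proj₁ (proj₂ γ-basis x) j))
  ... | yes c≈0 = yes (trans (proj₂ (proj₂ γ-basis x)) (sumFin-zero (λ j → trans (*-congʳ (ι-≈0 (c≈0 j))) (zeroˡ (γ j)))))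
  ... | no  c≉0 = no (λ x≈0 → c≉0 (proj₁ γ-basis _ (trans (sym (proj₂ (proj₂ γ-basis x))) x≈0)))

  ι-· : ∀ n → ι (n ·ᶠ F.1#) ≈ n · 1#
  ι-· zero    = 0#-homo
  ι-· (suc n) = trans (+-homo _ _) (+-cong 1#-homo (ι-· n))

  ι-^ : ∀ n c → ι (c Expᶠ.^ n) ≈ ι c ^ n
  ι-^ zero    c = 1#-homo
  ι-^ (suc n) c = trans (*-homo _ _) (*-congˡ (ι-^ n c))

  ^q-fixes-ι : ∀ c → ι c ^ q ≈ ι c
  ^q-fixes-ι c = trans (sym (ι-^ q c)) (⟦⟧-cong (FF.fermat c))

  ^-≉0 : ∀ {x} → ¬ x ≈ 0# → ∀ n → ¬ x ^ n ≈ 0#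
  ^-≉0 x≉0 zero    = 1≉0
  ^-≉0 x≉0 (suc n) = *-≉0 x≉0 (^-≉0 x≉0 n)

  module _ {p e : ℕ} (p-prime : Prime p) (q≡p^e : q ≡ p ^ℕ e) where

    [p·1]^n≈p^n·1 : ∀ n → (p · 1#) ^ n ≈ (p ^ℕ n) · 1#
    [p·1]^n≈p^n·1 zero    = sym (+-identityʳ 1#)
    [p·1]^n≈p^n·1 (suc n) = trans (*-congˡ ([p·1]^n≈p^n·1 n)) (sym (×1-homo-* p (p ^ℕ n)))

    p·1≈0 : p · 1# ≈ 0#
    p·1≈0 with ≈0? (p · 1#)
    ... | yes p·1≈0 = p·1≈0
    ... | no  p·1≉0 = ⊥-elim (^-≉0 p·1≉0 e (begin
      (p · 1#) ^ e       ≈⟨ [p·1]^n≈p^n·1 e ⟩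
      (p ^ℕ e) · 1#      ≈⟨ ×-congˡ (≡.sym q≡p^e) ⟩
      q · 1#             ≈⟨ ι-· q ⟨
      ι (q ·ᶠ F.1#)      ≈⟨ ι-≈0 FF.q·1≈0 ⟩
      0#                 ∎))

    ^q-additive : ∀ x y → (x + y) ^ q ≈ x ^ q + y ^ q
    ^q-additive x y rewrite q≡p^e = Frobenius.frobenius-+-^ L p-prime p·1≈0 e x y

corollary4p2 : (q : ℕ) → IsPrimePower q → (F : Field) → HasCard F q →
    (n k : ℕ) → 2 ≤ n → 0 < k → k < n →
    (m : ℕ) → 1 < m →
    (L : Field) (ι : Field.Carrier F → Field.Carrier L) → IsFieldHom F L ι →
    (γ : Fin m → Field.Carrier L) → IsBasisOver F L ι γ →
    ¬ QMatroid.Ext.PurelyMultilinear F n L ι γ (QMatroid.uniformRank F n k)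
corollary4p2 q (p , e , p-prime , _ , q≡p^e) F card n k _ _ k<n m _ L ι ι-hom γ γ-basis (_ , _ , ¬extRep)
  with n ℕ.≤? m
... | yes n≤m with ℕ.m≤n⇒∃[o]m+o≡n n≤m
...   | m′ , ≡.refl = ¬extRep (GabidulinCode.extRepresentable F L ι ι-hom ≈0? FF.1<q FF.enum FF.enum-injective
                                (^q-additive {e = e} p-prime q≡p^e) ^q-fixes-ι (ℕ.<⇒≤ k<n) γ γ-basis)
  where
  module FF = FiniteField F card
  open FiniteExtension F L ι ι-hom card γ γ-basis
corollary4p2 _ _ F card n k _ 0<k k<n m 1<m _ _ _ _ _ (_ , matRep , _)
    | no n≰m with column-split (ℕ.≰⇒> n≰m) 0<k k<n 1<m
...   | t , r , ≡.refl , r+k≤n , nt<mk =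
  MatrixCodes.uniform-not-MatRepresentable F (FiniteField.≈0? F card) n k<n r+k≤n nt<mk matRep
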